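{- For all integers $n\geq 0$ and $k\geq 2$, we have $O_{1,k}(n)=D_{1,k}(n)=E_k(n)$, where: $O_{1,k}(n)$ is the number of partitions of $n$ having exactly one distinct part size divisible by $k$ (that part size possibly repeated); $D_{1,k}(n)$ is the number of partitions of $n$ having exactly one distinct part size that occurs at least $k$ times; and $E_k(n)=A_k(n)-B_k(n)$, where $A_k(n)$ is the total number of parts congruent to $1 \pmod{k}$ (counted with multiplicity), summed over all partitions of $n$ in which no part is divisible by $k$, and $B_k(n)$ is the total number of distinct part sizes, summed over all partitions of $n$ in which no part occurs more than $k-1$ times.
   Context: A partition of a nonnegative integer $n$ is a finite weakly decreasing sequence of positive integers (its parts) summing to $n$; the empty partition is the unique partition of $0$. A partition in which no part is divisible by $k$ is called $k$-regular. The number of distinct part sizes of a partition is the number of distinct values occurring among its parts. -}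

module Defs where

open import Data.Nat using (ℕ; zero; suc; _+_; _≤_; _≥_; _<_; _%_; NonZero)
open import Data.Nat.Divisibility using (_∣_; _∣?_)
open import Data.Nat.Properties using (_≟_; _≤?_)
open import Data.Nat.ListAction using (sum)
open import Data.List using (List; []; _∷_; length; filter; map; deduplicate)
open import Data.List.Relation.Unary.All using (All)
open import Data.List.Relation.Unary.Linked using (Linked)
open import Data.List.Relation.Unary.Unique.Propositional using (Unique)
open import Data.List.Membership.Propositional using (_∈_)
open import Data.Integer using (ℤ; +_; _-_)
open import Function.Bundles using (_⇔_)
open import Relation.Binary.PropositionalEquality using (_≡_)
open import Relation.Nullary using (¬_)

record IsPartition (n : ℕ) (parts : List ℕ) : Set where
  field
    decreasing : Linked _≥_ parts
    positive   : All (0 <_) parts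
    sums       : sum parts ≡ n

-- Counting/summing over all
-- partitions of n is done over such a list (result independent of the choice).
record PartitionList (n : ℕ) : Set where
  field
    elems    : List (List ℕ)
    unique   : Unique elems
    complete : ∀ parts → (parts ∈ elems) ⇔ IsPartition n parts
open PartitionList public

distinctParts : List ℕ → List ℕ
distinctParts = deduplicate _≟_

mult : ℕ → List ℕ → ℕ
mult v parts = length (filter (v ≟_) parts)

numDistinctDivBy : ℕ → List ℕ → ℕ
numDistinctDivBy k parts = length (filter (k ∣?_) (distinctParts parts))

numDistinctRepeated : ℕ → List ℕ → ℕ
numDistinctRepeated k parts =
  length (filter (λ v → k ≤? mult v parts) (distinctParts parts))

KRegular : ℕ → List ℕ → Set
KRegular k parts = All (λ p → ¬ (k ∣ p)) parts

KDistinct : ℕ → List ℕ → Set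
KDistinct k parts = All (λ p → mult p parts < k) parts

numPartsOneModK : (k : ℕ) → .{{_ : NonZero k}} → List ℕ → ℕ
numPartsOneModK k parts = length (filter (λ p → (p % k) ≟ (1 % k)) parts)

numDistinct : List ℕ → ℕ
numDistinct parts = length (distinctParts parts)

module _ {P : List ℕ → Set} where
  open import Relation.Nullary using (Dec; yes; no)
  sumOver : (∀ x → Dec (P x)) → (List ℕ → ℕ) → List (List ℕ) → ℕ
  sumOver P? f [] = 0
  sumOver P? f (x ∷ xs) with P? x
  ... | yes _ = f x + sumOver P? f xs
  ... | no _  = sumOver P? f xs

open import Data.List.Relation.Unary.All using (all?)
open import Relation.Nullary using (¬?)
open import Data.Nat.Properties using (_<?_)

KRegular? : ∀ k parts → Relation.Nullary.Dec (KRegular k parts)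
KRegular? k = all? (λ p → ¬? (k ∣? p))

KDistinct? : ∀ k parts → Relation.Nullary.Dec (KDistinct k parts)
KDistinct? k parts = all? (λ p → mult p parts <? k) parts

O1 : (k n : ℕ) → PartitionList n → ℕ
O1 k n P = length (filter (λ parts → numDistinctDivBy k parts ≟ 1) (elems P))

D1 : (k n : ℕ) → PartitionList n → ℕ
D1 k n P = length (filter (λ parts → numDistinctRepeated k parts ≟ 1) (elems P))

A : (k n : ℕ) → .{{_ : NonZero k}} → PartitionList n → ℕ
A k n P = sumOver (KRegular? k) (numPartsOneModK k) (elems P)

B : (k n : ℕ) → PartitionList n → ℕ
B k n P = sumOver (KDistinct? k) numDistinct (elems P)

E : (k n : ℕ) → .{{_ : NonZero k}} → PartitionList n → ℤ
E k n P = + A k n P - + B k n P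

module Submission where

open import Defs
open import Data.Nat using (ℕ; _≤_; NonZero)
open import Data.Integer using (+_)
open import Data.Product using (_×_)
open import Relation.Binary.PropositionalEquality using (_≡_)

-- Proof by generating functions.  Write G_m = 1/(1-q^m), P_m = q^m/(1-q^m),
-- T_m = 1 + q^m + … + q^((k-1)m).  Then
--   Σ O₁ q^n = (Σ_(k∣m) P_m) · ∏_(k∤m) G_m,   Σ D₁ q^n = (Σ_a P_(ka)) · ∏_m T_m,
--   Σ A q^n  = (Σ_(r≡1) P_r) · ∏_(k∤m) G_m,   Σ (B + D₁) q^n = (Σ_j Q_j) · ∏_m T_m,
-- where Q_j = Σ_(c≡1 (mod k)) q^(cj); the last two use G_m = T_m · G_(km)
-- and P_m = T_m · Q_m.  The theorem follows from Glaisher's identity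
-- ∏_(k∤m) G_m = ∏_m T_m (cancel ∏_(k∣m) G_m = ∏_a G_(ka) from ∏_m G_m) and
-- the divisor identity Σ_(r≡1) P_r = Σ_j Q_j (both count the factorisations
-- n = r·c with r ≡ 1 (mod k)).

module FormalSeries where

  open import Data.Nat using (ℕ; zero; suc; _+_; _*_; _∸_; _≤_; _<_; z≤n; s≤s)
  open import Data.Nat.Properties
  open import Relation.Binary.PropositionalEquality
  open import Relation.Binary.Structures using (IsEquivalence)
  open import Algebra.Bundles using (CommutativeSemiring)
  open import Algebra.Structures using (IsMagma)
  open import Algebra.Structures.Biased using (IsCommutativeSemiringˡ)
  open import Algebra.Properties.CommutativeSemigroup +-commutativeSemigroup using (interchange)
  open import Data.Product using (_,_)

  Series : Set
  Series = ℕ → ℕ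

  infix 4 _≐_ _≈_
  _≐_ : Series → Series → Set
  f ≐ g = ∀ x → f x ≡ g x

  -- the same relation wrapped in a record, so that both sides can be inferred
  record _≈_ (f g : Series) : Set where
    constructor ext
    field at : f ≐ g
  open _≈_ public

  sumTo : (ℕ → ℕ) → ℕ → ℕ
  sumTo h zero = h 0
  sumTo h (suc x) = h 0 + sumTo (λ i → h (suc i)) x

  sumTo-cong : ∀ h h' x → (∀ i → i ≤ x → h i ≡ h' i) → sumTo h x ≡ sumTo h' x
  sumTo-cong h h' zero e = e 0 z≤n
  sumTo-cong h h' (suc x) e =
    cong₂ _+_ (e 0 z≤n) (sumTo-cong _ _ x (λ i i≤x → e (suc i) (s≤s i≤x)))

  sumTo-+ : ∀ h h' x → sumTo (λ i → h i + h' i) x ≡ sumTo h x + sumTo h' x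
  sumTo-+ h h' zero = refl
  sumTo-+ h h' (suc x) rewrite sumTo-+ (λ i → h (suc i)) (λ i → h' (suc i)) x =
    interchange (h 0) (h' 0) (sumTo (λ i → h (suc i)) x) (sumTo (λ i → h' (suc i)) x)

  sumTo-* : ∀ c h x → sumTo (λ i → c * h i) x ≡ c * sumTo h x
  sumTo-* c h zero = refl
  sumTo-* c h (suc x) rewrite sumTo-* c (λ i → h (suc i)) x = sym (*-distribˡ-+ c (h 0) _)

  sumTo-zeros : ∀ h x → (∀ i → i ≤ x → h i ≡ 0) → sumTo h x ≡ 0
  sumTo-zeros h zero e = e 0 z≤n
  sumTo-zeros h (suc x) e =
    cong₂ _+_ (e 0 z≤n) (sumTo-zeros _ x (λ i i≤x → e (suc i) (s≤s i≤x)))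

  sumTo-last : ∀ h x → sumTo h (suc x) ≡ sumTo h x + h (suc x)
  sumTo-last h zero = refl
  sumTo-last h (suc x) rewrite sumTo-last (λ i → h (suc i)) x = sym (+-assoc (h 0) _ _)

  sumTo-reverse : ∀ h x → sumTo h x ≡ sumTo (λ i → h (x ∸ i)) x
  sumTo-reverse h zero = refl
  sumTo-reverse h (suc x) = begin
    sumTo h (suc x)                        ≡⟨ sumTo-last h x ⟩
    sumTo h x + h (suc x)                  ≡⟨ +-comm (sumTo h x) _ ⟩
    h (suc x) + sumTo h x                  ≡⟨ cong (_+_ (h (suc x))) (sumTo-reverse h x) ⟩
    h (suc x) + sumTo (λ i → h (x ∸ i)) x  ∎
    where open ≡-Reasoning

  sumTo-pad : ∀ h z d → (∀ i → z < i → h i ≡ 0) → sumTo h (z + d) ≡ sumTo h z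
  sumTo-pad h z zero e = cong (sumTo h) (+-identityʳ z)
  sumTo-pad h z (suc d) e = begin
    sumTo h (z + suc d)            ≡⟨ cong (sumTo h) (+-suc z d) ⟩
    sumTo h (suc (z + d))          ≡⟨ sumTo-last h (z + d) ⟩
    sumTo h (z + d) + h (suc (z + d))
      ≡⟨ cong₂ _+_ (sumTo-pad h z d e) (e (suc (z + d)) (s≤s (m≤m+n z d))) ⟩
    sumTo h z + 0                  ≡⟨ +-identityʳ _ ⟩
    sumTo h z                      ∎
    where open ≡-Reasoning

  shift : Series → Series
  shift f i = f (suc i)

  scale : ℕ → Series → Series
  scale c f x = c * f x

  𝟘 𝟙 : Series
  𝟘 _ = 0
  𝟙 zero = 1
  𝟙 (suc _) = 0

  constant : ℕ → Series
  constant c = scale c 𝟙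

  infixl 7 _⊛_
  infixl 6 _⊕_

  -- Sum and Cauchy product are kept opaque: all reasoning about them goes
  -- through the lemmas below, which keeps unification cheap.
  opaque
    _⊛_ : Series → Series → Series
    (f ⊛ g) x = sumTo (λ i → f i * g (x ∸ i)) x

    _⊕_ : Series → Series → Series
    (f ⊕ g) x = f x + g x

    ⊛-0 : ∀ f g → (f ⊛ g) 0 ≡ f 0 * g 0
    ⊛-0 f g = refl

    ⊕-def : ∀ f g x → (f ⊕ g) x ≡ f x + g x
    ⊕-def f g x = refl

    ⊛-comm : ∀ f g → f ⊛ g ≐ g ⊛ f
    ⊛-comm f g x = trans (sumTo-reverse _ x) (sumTo-cong _ _ x λ i i≤x →
      trans (cong (λ z → f (x ∸ i) * g z) (m∸[m∸n]≡n i≤x)) (*-comm (f (x ∸ i)) (g i)))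

    ⊛-congˡ : ∀ {f f'} g → f ≐ f' → f ⊛ g ≐ f' ⊛ g
    ⊛-congˡ g e x = sumTo-cong _ _ x λ i _ → cong (_* _) (e i)

    ⊛-congʳ : ∀ f {g g'} → g ≐ g' → f ⊛ g ≐ f ⊛ g'
    ⊛-congʳ f e x = sumTo-cong _ _ x λ i _ → cong (f i *_) (e (x ∸ i))

    ⊛-distribʳ : ∀ h f g → (f ⊕ g) ⊛ h ≐ f ⊛ h ⊕ g ⊛ h
    ⊛-distribʳ h f g x =
      trans (sumTo-cong _ _ x λ i _ → *-distribʳ-+ (h (x ∸ i)) (f i) (g i)) (sumTo-+ _ _ x)

    ⊛-zeroˡ : ∀ f → 𝟘 ⊛ f ≐ 𝟘
    ⊛-zeroˡ f x = sumTo-zeros _ x (λ _ _ → refl)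

    ⊛-identityˡ : ∀ f → 𝟙 ⊛ f ≐ f
    ⊛-identityˡ f zero = +-identityʳ (f 0)
    ⊛-identityˡ f (suc x) =
      trans (cong₂ _+_ (+-identityʳ (f (suc x))) (sumTo-zeros _ x (λ _ _ → refl))) (+-identityʳ _)

    ⊛-scaleˡ : ∀ c f g → scale c f ⊛ g ≐ scale c (f ⊛ g)
    ⊛-scaleˡ c f g x = trans (sumTo-cong _ _ x (λ i _ → *-assoc c (f i) _)) (sumTo-* c _ x)

    -- associativity, by induction on the degree: the coefficients of
    -- shift (f ⊛ g) are those of scale (f 0) (shift g) ⊕ shift f ⊛ g
    ⊛-assoc : ∀ f g h → (f ⊛ g) ⊛ h ≐ f ⊛ (g ⊛ h)
    ⊛-assoc f g h zero = *-assoc (f 0) (g 0) (h 0)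
    ⊛-assoc f g h (suc x) = begin
      (f 0 * g 0) * h (suc x) + (shift (f ⊛ g) ⊛ h) x
        ≡⟨ cong (_+_ (f 0 * g 0 * h (suc x))) (⊛-distribʳ h (scale (f 0) (shift g)) (shift f ⊛ g) x) ⟩
      (f 0 * g 0) * h (suc x) + ((scale (f 0) (shift g) ⊛ h) x + ((shift f ⊛ g) ⊛ h) x)
        ≡⟨ cong₂ (λ a b → (f 0 * g 0) * h (suc x) + (a + b))
                 (⊛-scaleˡ (f 0) (shift g) h x) (⊛-assoc (shift f) g h x) ⟩
      (f 0 * g 0) * h (suc x) + (f 0 * (shift g ⊛ h) x + (shift f ⊛ (g ⊛ h)) x)
        ≡⟨ sym (+-assoc (f 0 * g 0 * h (suc x)) _ _) ⟩
      ((f 0 * g 0) * h (suc x) + f 0 * (shift g ⊛ h) x) + (shift f ⊛ (g ⊛ h)) x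
        ≡⟨ cong (_+ (shift f ⊛ (g ⊛ h)) x)
             (trans (cong (_+ f 0 * (shift g ⊛ h) x) (*-assoc (f 0) (g 0) _))
                    (sym (*-distribˡ-+ (f 0) _ _))) ⟩
      f 0 * (g 0 * h (suc x) + (shift g ⊛ h) x) + (shift f ⊛ (g ⊛ h)) x ∎
      where open ≡-Reasoning

    ≈-isEquivalence : IsEquivalence _≈_
    ≈-isEquivalence = record
      { refl  = ext (λ x → refl)
      ; sym   = λ e → ext (λ x → sym (at e x))
      ; trans = λ e e' → ext (λ x → trans (at e x) (at e' x)) }

    ⊕-isMagma : IsMagma _≈_ _⊕_
    ⊕-isMagma = record
      { isEquivalence = ≈-isEquivalence
      ; ∙-cong = λ e e' → ext (λ x → cong₂ _+_ (at e x) (at e' x)) }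

    ⊛-isMagma : IsMagma _≈_ _⊛_
    ⊛-isMagma = record
      { isEquivalence = ≈-isEquivalence
      ; ∙-cong = λ {f} {f'} {g} {g'} e e' →
          ext (λ x → trans (⊛-congˡ g (at e) x) (⊛-congʳ f' (at e') x)) }

    isCommutativeSemiringˡ : IsCommutativeSemiringˡ _≈_ _⊕_ _⊛_ 𝟘 𝟙
    isCommutativeSemiringˡ = record
      { +-isCommutativeMonoid = record
        { isMonoid = record
          { isSemigroup = record
            { isMagma = ⊕-isMagma ; assoc = λ f g h → ext (λ x → +-assoc (f x) (g x) (h x)) }
          ; identity = (λ f → ext (λ x → refl)) , (λ f → ext (λ x → +-identityʳ (f x))) }
        ; comm = λ f g → ext (λ x → +-comm (f x) (g x)) }
      ; *-isCommutativeMonoid = record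
        { isMonoid = record
          { isSemigroup = record { isMagma = ⊛-isMagma ; assoc = λ f g h → ext (⊛-assoc f g h) }
          ; identity = (λ f → ext (⊛-identityˡ f))
                     , (λ f → ext (λ x → trans (⊛-comm f 𝟙 x) (⊛-identityˡ f x))) }
        ; comm = λ f g → ext (⊛-comm f g) }
      ; distribʳ = λ h f g → ext (⊛-distribʳ h f g)
      ; zeroˡ = λ f → ext (⊛-zeroˡ f) }

  seriesSemiring : CommutativeSemiring _ _
  seriesSemiring = record
    { Carrier = Series ; _≈_ = _≈_ ; _+_ = _⊕_ ; _*_ = _⊛_ ; 0# = 𝟘 ; 1# = 𝟙
    ; isCommutativeSemiring = IsCommutativeSemiringˡ.isCommutativeSemiring isCommutativeSemiringˡ }

  module Laws = CommutativeSemiring seriesSemiring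

  open CommutativeSemiring seriesSemiring public
    using (setoid)
    renaming (refl to ≈-refl; sym to ≈-sym; trans to ≈-trans; +-cong to ⊕-cong; *-cong to ⊛-cong)

  ⊕-cancelʳ : ∀ {f g} h → f ⊕ h ≈ g ⊕ h → f ≈ g
  ⊕-cancelʳ {f} {g} h e = ext λ x →
    +-cancelʳ-≡ (h x) (f x) (g x) (trans (sym (⊕-def f h x)) (trans (at e x) (⊕-def g h x)))

  ⊕-cancelˡ : ∀ {f g} h → h ⊕ f ≈ h ⊕ g → f ≈ g
  ⊕-cancelˡ {f} {g} h e = ext λ x →
    +-cancelˡ-≡ (h x) (f x) (g x) (trans (sym (⊕-def h f x)) (trans (at e x) (⊕-def h g x)))

  import Algebra.Solver.Ring.NaturalCoefficients.Default
  module SeriesSolver = Algebra.Solver.Ring.NaturalCoefficients.Default seriesSemiring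

module Profiles where

  open import Data.Nat using (ℕ; zero; suc; _+_; _*_; _∸_; _≤_; _<_; s≤s; >-nonZero)
  open import Data.Nat.Properties
  open import Relation.Binary.PropositionalEquality
  open import Relation.Nullary using (Dec; yes; no; ¬_; does)
  open import Data.Bool using (if_then_else_)
  open import Data.Empty using (⊥-elim)
  open FormalSeries

  𝕀 : ∀ {p} {P : Set p} → Dec P → ℕ
  𝕀 d = if does d then 1 else 0

  𝕀-cong : ∀ {p q} {P : Set p} {Q : Set q} (d : Dec P) (e : Dec Q) →
           (P → Q) → (Q → P) → 𝕀 d ≡ 𝕀 e
  𝕀-cong (yes _) (yes _) _ _ = refl
  𝕀-cong (yes p) (no ¬q) f g = ⊥-elim (¬q (f p))
  𝕀-cong (no ¬p) (yes q) f g = ⊥-elim (¬p (g q))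
  𝕀-cong (no _) (no _) _ _ = refl

  𝕀-no : ∀ {p} {P : Set p} (d : Dec P) → ¬ P → 𝕀 d ≡ 0
  𝕀-no (yes p) ¬p = ⊥-elim (¬p p)
  𝕀-no (no _) _ = refl

  𝕀-yes : ∀ {p} {P : Set p} (d : Dec P) → P → 𝕀 d ≡ 1
  𝕀-yes (yes _) _ = refl
  𝕀-yes (no ¬p) p = ⊥-elim (¬p p)

  when : ∀ {p} {P : Set p} → Dec P → ℕ → ℕ
  when (yes _) v = v
  when (no _) v = 0

  when-no : ∀ {p} {P : Set p} (d : Dec P) v → ¬ P → when d v ≡ 0
  when-no (yes p) v ¬p = ⊥-elim (¬p p)
  when-no (no _) v _ = refl

  when-+ : ∀ {p} {P : Set p} (d : Dec P) x y → when d (x + y) ≡ when d x + when d y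
  when-+ (yes _) x y = refl
  when-+ (no _) x y = refl

  X^_ : ℕ → Series
  X^ m = λ i → 𝕀 (i ≟ m)

  X^0≈𝟙 : X^ 0 ≈ 𝟙
  X^0≈𝟙 = ext λ { zero → refl ; (suc x) → refl }

  -- profile m a = Σ_c a(c) q^(c·m): the contribution of a part size m when the
  -- multiplicity c of m is weighted by a(c)
  profile : ℕ → (ℕ → ℕ) → Series
  profile m a x = sumTo (λ c → 𝕀 (c * m ≟ x) * a c) x

  profile-cong : ∀ m a b → (∀ c → a c ≡ b c) → profile m a ≈ profile m b
  profile-cong m a b e = ext λ x → sumTo-cong _ _ x (λ c _ → cong (𝕀 (c * m ≟ x) *_) (e c))

  profile-zero : ∀ m → profile m (λ _ → 0) ≈ 𝟘
  profile-zero m = ext λ x → sumTo-zeros _ x (λ c _ → *-zeroʳ (𝕀 (c * m ≟ x)))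

  profile-+ : ∀ m a b → profile m (λ c → a c + b c) ≈ profile m a ⊕ profile m b
  profile-+ m a b = ext λ x → trans
    (trans (sumTo-cong _ _ x (λ c _ → *-distribˡ-+ (𝕀 (c * m ≟ x)) (a c) (b c))) (sumTo-+ _ _ x))
    (sym (⊕-def _ _ x))

  -- the coefficient of q^x in a profile may be summed over any range c ≤ y
  -- with x ≤ y, since c·m = x forces c ≤ x
  profile-range : ∀ m → 1 ≤ m → ∀ a x y → x ≤ y →
                  sumTo (λ c → 𝕀 (c * m ≟ x) * a c) y ≡ profile m a x
  profile-range m 1≤m a x y x≤y = begin
    sumTo h y             ≡⟨ cong (sumTo h) (sym (m+[n∸m]≡n x≤y)) ⟩
    sumTo h (x + (y ∸ x)) ≡⟨ sumTo-pad h x (y ∸ x) vanish ⟩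
    sumTo h x             ∎
    where
    open ≡-Reasoning
    h : ℕ → ℕ
    h c = 𝕀 (c * m ≟ x) * a c
    vanish : ∀ c → x < c → h c ≡ 0
    vanish c x<c =
      cong (_* a c) (𝕀-no (c * m ≟ x) (λ e → <⇒≢ (<-≤-trans x<c (m≤m*n c m {{>-nonZero 1≤m}})) (sym e)))

  sumTo-delta : ∀ m h x → sumTo (λ i → 𝕀 (i ≟ m) * h i) x ≡ when (m ≤? x) (h m)
  sumTo-delta zero h zero = +-identityʳ (h 0)
  sumTo-delta zero h (suc x) =
    trans (cong (_+_ (h 0 + 0)) (sumTo-zeros _ x (λ _ _ → refl))) (trans (+-identityʳ _) (+-identityʳ _))
  sumTo-delta (suc m) h zero = refl
  sumTo-delta (suc m) h (suc x) with sumTo-delta m (λ i → h (suc i)) x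
  ... | e with m ≤? x | suc m ≤? suc x
  ... | yes _ | yes _ = e
  ... | yes p | no ¬p = ⊥-elim (¬p (s≤s p))
  ... | no ¬p | yes p = ⊥-elim (¬p (≤-pred p))
  ... | no _ | no _ = e

  opaque
    unfolding _⊛_

    X^-⊛ : ∀ m f x → (X^ m ⊛ f) x ≡ when (m ≤? x) (f (x ∸ m))
    X^-⊛ m f x = sumTo-delta m (λ i → f (x ∸ i)) x

  X^-+ : ∀ a b → X^ a ⊛ X^ b ≈ X^ (a + b)
  X^-+ a b = ext λ x → trans (X^-⊛ a (X^ b) x) (coeff x (a ≤? x))
    where
    coeff : ∀ x (d : Dec (a ≤ x)) → when d ((X^ b) (x ∸ a)) ≡ (X^ (a + b)) x
    coeff x (yes a≤x) = 𝕀-cong (x ∸ a ≟ b) (x ≟ a + b)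
      (λ e → trans (sym (m+[n∸m]≡n a≤x)) (cong (_+_ a) e))
      (λ e → trans (cong (_∸ a) e) (m+n∸m≡n a b))
    coeff x (no a≰x) = sym (𝕀-no (x ≟ a + b) (λ e → a≰x (subst (a ≤_) (sym e) (m≤m+n a b))))

  profile-unfold : ∀ m → 1 ≤ m → ∀ a →
                   profile m a ≈ constant (a 0) ⊕ X^ m ⊛ profile m (λ c → a (suc c))
  profile-unfold m 1≤m a = ext λ x → trans (coeff x) (sym (⊕-def _ _ x))
    where
    a′ : ℕ → ℕ
    a′ c = a (suc c)
    coeff : ∀ x → profile m a x ≡ constant (a 0) x + (X^ m ⊛ profile m a′) x
    coeff zero rewrite X^-⊛ m (profile m a′) 0 with m ≤? 0
    ... | yes m≤0 = ⊥-elim (1+n≰n (≤-trans 1≤m m≤0))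
    ... | no _ = trans (+-identityʳ (a 0)) (sym (trans (+-identityʳ (a 0 * 1)) (*-identityʳ (a 0))))
    coeff (suc y) rewrite X^-⊛ m (profile m a′) (suc y) with m ≤? suc y
    ... | yes m≤ = begin
      0 + sumTo (λ c → 𝕀 (m + c * m ≟ suc y) * a′ c) y
        ≡⟨ sumTo-cong _ _ y (λ c _ → cong (_* a′ c) (𝕀-cong (m + c * m ≟ suc y) (c * m ≟ z)
             (λ e → +-cancelˡ-≡ m _ _ (trans e (sym m+z))) (λ e → trans (cong (_+_ m) e) m+z))) ⟩
      sumTo (λ c → 𝕀 (c * m ≟ z) * a′ c) y
        ≡⟨ profile-range m 1≤m a′ z y (∸-monoʳ-≤ (suc y) 1≤m) ⟩
      profile m a′ z
        ≡⟨ cong (_+ profile m a′ z) (sym (*-zeroʳ (a 0))) ⟩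
      a 0 * 0 + profile m a′ z ∎
      where
      open ≡-Reasoning
      z : ℕ
      z = suc y ∸ m
      m+z : m + z ≡ suc y
      m+z = m+[n∸m]≡n m≤
    ... | no m≰ = trans
      (sumTo-zeros _ y (λ c _ → cong (_* a′ c) (𝕀-no (m + c * m ≟ suc y)
        (λ e → m≰ (subst (m ≤_) e (m≤m+n m _))))))
      (sym (trans (+-identityʳ (a 0 * 0)) (*-zeroʳ (a 0))))

  unique-fixpoint : ∀ m → 1 ≤ m → ∀ u f g →
                    f ≈ u ⊕ X^ m ⊛ f → g ≈ u ⊕ X^ m ⊛ g → f ≈ g
  unique-fixpoint m 1≤m u f g ef eg = ext λ x → below (suc x) x ≤-refl
    where
    below : ∀ n x → x < n → f x ≡ g x
    below zero x ()
    below (suc n) x (s≤s x≤n) = begin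
      f x                                  ≡⟨ at ef x ⟩
      (u ⊕ X^ m ⊛ f) x                     ≡⟨ ⊕-def _ _ x ⟩
      u x + (X^ m ⊛ f) x                   ≡⟨ cong (_+_ (u x)) (X^-⊛ m f x) ⟩
      u x + when (m ≤? x) (f (x ∸ m))      ≡⟨ cong (_+_ (u x)) (earlier (m ≤? x)) ⟩
      u x + when (m ≤? x) (g (x ∸ m))      ≡⟨ cong (_+_ (u x)) (sym (X^-⊛ m g x)) ⟩
      u x + (X^ m ⊛ g) x                   ≡⟨ sym (⊕-def _ _ x) ⟩
      (u ⊕ X^ m ⊛ g) x                     ≡⟨ sym (at eg x) ⟩
      g x                                  ∎
      where
      open ≡-Reasoning
      earlier : (d : Dec (m ≤ x)) → when d (f (x ∸ m)) ≡ when d (g (x ∸ m))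
      earlier (yes m≤x) = below n (x ∸ m) (<-≤-trans (∸-monoʳ-< {x} {m} {0} 1≤m m≤x) x≤n)
      earlier (no _) = refl

module Truncated where

  open import Data.Nat using (ℕ; zero; suc; _+_; _*_; _∸_; _≤_; _<_; z≤n; s≤s)
  open import Data.Nat.Properties
  open import Relation.Binary.PropositionalEquality
  open import Data.Sum using (inj₁; inj₂)
  open FormalSeries

  infix 4 _≈[_]_
  _≈[_]_ : Series → ℕ → Series → Set
  f ≈[ N ] g = ∀ x → x ≤ N → f x ≡ g x

  ≈⇒≈[_] : ∀ N {f g} → f ≈ g → f ≈[ N ] g
  ≈⇒≈[ N ] e x _ = at e x

  ≈[]-trans : ∀ {f g h} N → f ≈[ N ] g → g ≈[ N ] h → f ≈[ N ] h
  ≈[]-trans N e e' x le = trans (e x le) (e' x le)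

  ≈[]-sym : ∀ {f g} N → f ≈[ N ] g → g ≈[ N ] f
  ≈[]-sym N e x le = sym (e x le)

  opaque
    unfolding _⊛_ _⊕_

    ⊕-upTo : ∀ N {f f' g g'} → f ≈[ N ] f' → g ≈[ N ] g' → f ⊕ g ≈[ N ] f' ⊕ g'
    ⊕-upTo N e e' x le = cong₂ _+_ (e x le) (e' x le)

    ⊛-upTo : ∀ N {f f' g g'} → f ≈[ N ] f' → g ≈[ N ] g' → f ⊛ g ≈[ N ] f' ⊛ g'
    ⊛-upTo N e e' x le = sumTo-cong _ _ x
      (λ i i≤x → cong₂ _*_ (e i (≤-trans i≤x le)) (e' (x ∸ i) (≤-trans (m∸n≤m x i) le)))

    cancel-upTo : ∀ c → c 0 ≡ 1 → ∀ a b N → a ⊛ c ≈[ N ] b ⊛ c → a ≈[ N ] b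
    cancel-upTo c c0 a b zero e .zero z≤n = begin
      a 0          ≡⟨ sym (*-identityʳ (a 0)) ⟩
      a 0 * 1      ≡⟨ cong (a 0 *_) (sym c0) ⟩
      a 0 * c 0    ≡⟨ e 0 z≤n ⟩
      b 0 * c 0    ≡⟨ cong (b 0 *_) c0 ⟩
      b 0 * 1      ≡⟨ *-identityʳ (b 0) ⟩
      b 0          ∎
      where open ≡-Reasoning
    cancel-upTo c c0 a b (suc N) e = extend (cancel-upTo c c0 a b N (λ y y≤N → e y (m≤n⇒m≤1+n y≤N)))
      where
      -- the coefficient of degree N + 1 is determined by the lower ones
      extend : a ≈[ N ] b → a ≈[ suc N ] b
      extend earlier x x≤N+1 with m≤n⇒m<n∨m≡n x≤N+1
      ... | inj₁ (s≤s x≤N) = earlier x x≤N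
      ... | inj₂ refl = +-cancelʳ-≡ _ _ _ (begin
        a (suc N) + (shift c ⊛ a) N       ≡⟨ cong (_+ (shift c ⊛ a) N) (sym (lead a)) ⟩
        c 0 * a (suc N) + (shift c ⊛ a) N ≡⟨ ⊛-comm c a (suc N) ⟩
        (a ⊛ c) (suc N)                   ≡⟨ e (suc N) ≤-refl ⟩
        (b ⊛ c) (suc N)                   ≡⟨ ⊛-comm b c (suc N) ⟩
        c 0 * b (suc N) + (shift c ⊛ b) N ≡⟨ cong₂ _+_ (lead b) lower ⟩
        b (suc N) + (shift c ⊛ a) N       ∎)
        where
        open ≡-Reasoning
        lead : (f : Series) → c 0 * f (suc N) ≡ f (suc N)
        lead f = trans (cong (_* f (suc N)) c0) (*-identityˡ (f (suc N)))
        lower : (shift c ⊛ b) N ≡ (shift c ⊛ a) N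
        lower = ⊛-upTo N {shift c} {shift c} (λ _ _ → refl) (≈[]-sym N earlier) N ≤-refl

-- Profiles of geometric type for a part size m ≥ 1:
--   G m = 1/(1-q^m),  P m = q^m/(1-q^m),  W m = Σ_c c q^(cm),
--   Below a m = 1 + q^m + … + q^((a-1)m)  (multiplicity < a).
module GeometricProfiles where

  open import Data.Nat using (ℕ; zero; suc; _+_; _*_; _≤_; _<_)
  open import Data.Nat.Properties
  open FormalSeries
  open Profiles
  open import Relation.Binary.Reasoning.Setoid setoid
  open SeriesSolver using (solve; _:+_; _:*_; _:=_; con)

  G P W : ℕ → Series
  G m = profile m (λ _ → 1)
  P m = profile m (λ c → 𝕀 (1 ≤? c))
  W m = profile m (λ c → c)

  Below : ℕ → ℕ → Series
  Below a m = profile m (λ c → 𝕀 (c <? a))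

  constant-0 : ∀ f → constant 0 ⊕ f ≈ f
  constant-0 f = ext λ x → ⊕-def _ _ x

  constant-1 : ∀ f → constant 1 ⊕ f ≈ 𝟙 ⊕ f
  constant-1 f = ⊕-cong (ext λ x → +-identityʳ (𝟙 x)) ≈-refl

  module _ (m : ℕ) (1≤m : 1 ≤ m) where

    G-unfold : G m ≈ 𝟙 ⊕ X^ m ⊛ G m
    G-unfold = ≈-trans (profile-unfold m 1≤m (λ _ → 1)) (constant-1 _)

    P≈X^G : P m ≈ X^ m ⊛ G m
    P≈X^G = ≈-trans (profile-unfold m 1≤m (λ c → 𝕀 (1 ≤? c))) (constant-0 _)

    -- W m = q^m (W m + G m), and P m ⊛ G m satisfies the same recursion
    W≈P⊛G : W m ≈ P m ⊛ G m
    W≈P⊛G = unique-fixpoint m 1≤m (X^ m ⊛ G m) (W m) (P m ⊛ G m)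
      (begin
        W m                         ≈⟨ ≈-trans (profile-unfold m 1≤m (λ c → c)) (constant-0 _) ⟩
        X^ m ⊛ profile m suc        ≈⟨ ⊛-cong ≈-refl (≈-trans (profile-cong m suc (λ c → c + 1) (λ c → +-comm 1 c))
                                                             (profile-+ m (λ c → c) (λ _ → 1))) ⟩
        X^ m ⊛ (W m ⊕ G m)          ≈⟨ solve 3 (λ x w g → x :* (w :+ g) := x :* g :+ x :* w) ≈-refl (X^ m) (W m) (G m) ⟩
        X^ m ⊛ G m ⊕ X^ m ⊛ W m    ∎)
      (begin
        P m ⊛ G m                                  ≈⟨ ⊛-cong P≈X^G G-unfold ⟩
        X^ m ⊛ G m ⊛ (𝟙 ⊕ X^ m ⊛ G m)
          ≈⟨ solve 2 (λ x g → x :* g :* (con 1 :+ x :* g) := x :* g :+ x :* (x :* g :* g)) ≈-refl (X^ m) (G m) ⟩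
        X^ m ⊛ G m ⊕ X^ m ⊛ (X^ m ⊛ G m ⊛ G m)     ≈⟨ ⊕-cong ≈-refl (⊛-cong ≈-refl (⊛-cong (≈-sym P≈X^G) ≈-refl)) ⟩
        X^ m ⊛ G m ⊕ X^ m ⊛ (P m ⊛ G m)            ∎)

    Below-unfold : ∀ a → Below (suc a) m ≈ 𝟙 ⊕ X^ m ⊛ Below a m
    Below-unfold a = ≈-trans (profile-unfold m 1≤m _) (constant-1 _)

    Below-telescope : ∀ a → Below a m ⊕ X^ (a * m) ≈ 𝟙 ⊕ X^ m ⊛ Below a m
    Below-telescope zero = begin
      Below 0 m ⊕ X^ 0        ≈⟨ ⊕-cong (profile-zero m) X^0≈𝟙 ⟩
      𝟘 ⊕ 𝟙                  ≈⟨ solve 1 (λ x → con 0 :+ con 1 := con 1 :+ x :* con 0) ≈-refl (X^ m) ⟩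
      𝟙 ⊕ X^ m ⊛ 𝟘           ≈⟨ ⊕-cong ≈-refl (⊛-cong ≈-refl (≈-sym (profile-zero m))) ⟩
      𝟙 ⊕ X^ m ⊛ Below 0 m   ∎
    Below-telescope (suc a) = begin
      Below (suc a) m ⊕ X^ (m + a * m)
        ≈⟨ ⊕-cong (Below-unfold a) (≈-sym (X^-+ m (a * m))) ⟩
      (𝟙 ⊕ X^ m ⊛ Below a m) ⊕ X^ m ⊛ X^ (a * m)
        ≈⟨ solve 3 (λ x t y → (con 1 :+ x :* t) :+ x :* y := con 1 :+ x :* (t :+ y)) ≈-refl (X^ m) (Below a m) (X^ (a * m)) ⟩
      𝟙 ⊕ X^ m ⊛ (Below a m ⊕ X^ (a * m))
        ≈⟨ ⊕-cong ≈-refl (⊛-cong ≈-refl (≈-trans (Below-telescope a) (≈-sym (Below-unfold a)))) ⟩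
      𝟙 ⊕ X^ m ⊛ Below (suc a) m ∎

  geometric-factor : ∀ a m → 1 ≤ a → 1 ≤ m → G m ≈ Below a m ⊛ G (a * m)
  geometric-factor a m 1≤a 1≤m = unique-fixpoint m 1≤m 𝟙 (G m) (Bₐ ⊛ Gₐ) (G-unfold m 1≤m)
    (≈-sym (⊕-cancelʳ (y ⊛ Gₐ) (begin
      (𝟙 ⊕ x ⊛ (Bₐ ⊛ Gₐ)) ⊕ y ⊛ Gₐ
        ≈⟨ solve 4 (λ x t h y → (con 1 :+ x :* (t :* h)) :+ y :* h := (con 1 :+ y :* h) :+ (x :* t) :* h) ≈-refl x Bₐ Gₐ y ⟩
      (𝟙 ⊕ y ⊛ Gₐ) ⊕ (x ⊛ Bₐ) ⊛ Gₐ   ≈⟨ ⊕-cong (≈-sym (G-unfold (a * m) 1≤am)) ≈-refl ⟩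
      Gₐ ⊕ (x ⊛ Bₐ) ⊛ Gₐ             ≈⟨ solve 3 (λ x t h → h :+ (x :* t) :* h := (con 1 :+ x :* t) :* h) ≈-refl x Bₐ Gₐ ⟩
      (𝟙 ⊕ x ⊛ Bₐ) ⊛ Gₐ             ≈⟨ ⊛-cong (≈-sym (Below-telescope m 1≤m a)) ≈-refl ⟩
      (Bₐ ⊕ y) ⊛ Gₐ                 ≈⟨ solve 3 (λ t y h → (t :+ y) :* h := t :* h :+ y :* h) ≈-refl Bₐ y Gₐ ⟩
      Bₐ ⊛ Gₐ ⊕ y ⊛ Gₐ               ∎)))
    where
    x y Bₐ Gₐ : Series
    x = X^ m
    y = X^ (a * m)
    Bₐ = Below a m
    Gₐ = G (a * m)
    1≤am : 1 ≤ a * m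
    1≤am = *-mono-≤ 1≤a 1≤m

-- Profiles attached to a part size j ≥ 1 and a modulus k = k' + 2:
--   T j = 1 + q^j + … + q^((k-1)j)  (multiplicity < k),
--   U j  : multiplicity ≥ k,   V j : 1 ≤ multiplicity < k,
--   Q j  : multiplicity ≡ 1 (mod k).
module PartSize (k' : ℕ) where

  open import Data.Nat using (ℕ; zero; suc; _+_; _*_; _≤_; _<_; z≤n; s≤s; _%_)
  open import Data.Nat.Properties
  open import Data.Nat.DivMod using ([m+n]%n≡m%n; m<n⇒m%n≡m)
  open import Relation.Binary.PropositionalEquality as ≡ using (_≡_; refl; cong)
  open import Relation.Nullary using (yes; no)
  open FormalSeries
  open Profiles
  open GeometricProfiles
  open import Relation.Binary.Reasoning.Setoid setoid
  open SeriesSolver using (solve; _:+_; _:*_; _:=_; con)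

  k : ℕ
  k = suc (suc k')

  T U V Q : ℕ → Series
  T j = Below k j
  U j = profile j (λ c → 𝕀 (k ≤? c))
  V j = profile j (λ c → 𝕀 (c <? k) * 𝕀 (1 ≤? c))
  Q j = profile j (λ c → 𝕀 (c % k ≟ 1))

  module _ (j : ℕ) (1≤j : 1 ≤ j) where

    1≤kj : 1 ≤ k * j
    1≤kj = *-mono-≤ {1} {k} (s≤s z≤n) 1≤j

    glaisher-factor : G j ≈ T j ⊛ G (k * j)
    glaisher-factor = geometric-factor k j (s≤s z≤n) 1≤j

    V⊕U≈P : V j ⊕ U j ≈ P j
    V⊕U≈P = ≈-trans (≈-sym (profile-+ j _ _)) (profile-cong j _ _ split)
      where
      split : ∀ c → 𝕀 (c <? k) * 𝕀 (1 ≤? c) + 𝕀 (k ≤? c) ≡ 𝕀 (1 ≤? c)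
      split zero = refl
      split (suc c) with suc c <? k
      ... | yes c<k rewrite 𝕀-yes (suc c <? k) c<k | 𝕀-no (k ≤? suc c) (<⇒≱ c<k) = refl
      ... | no c≮k rewrite 𝕀-no (suc c <? k) c≮k | 𝕀-yes (k ≤? suc c) (≮⇒≥ c≮k) = refl

    T≈𝟙⊕V : T j ≈ 𝟙 ⊕ V j
    T≈𝟙⊕V = begin
      T j                                               ≈⟨ profile-unfold j 1≤j _ ⟩
      constant 1 ⊕ X^ j ⊛ profile j (λ c → 𝕀 (suc c <? k)) ≈⟨ constant-1 _ ⟩
      𝟙 ⊕ X^ j ⊛ profile j (λ c → 𝕀 (suc c <? k))
        ≈⟨ ⊕-cong ≈-refl (≈-sym (≈-trans (profile-unfold j 1≤j _) (≈-trans (constant-0 _)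
             (⊛-cong ≈-refl (profile-cong j _ _ (λ c → *-identityʳ _)))))) ⟩
      𝟙 ⊕ V j                                           ∎

    U≈T⊛P : U j ≈ T j ⊛ P (k * j)
    U≈T⊛P = ⊕-cancelˡ (V j) (≈-trans V⊕U≈P (⊕-cancelˡ 𝟙 (begin
      𝟙 ⊕ P j                      ≈⟨ ⊕-cong ≈-refl (P≈X^G j 1≤j) ⟩
      𝟙 ⊕ X^ j ⊛ G j               ≈⟨ ≈-sym (G-unfold j 1≤j) ⟩
      G j                          ≈⟨ glaisher-factor ⟩
      T j ⊛ G (k * j)              ≈⟨ ⊛-cong ≈-refl (G-unfold (k * j) 1≤kj) ⟩
      T j ⊛ (𝟙 ⊕ X^ (k * j) ⊛ G (k * j))
        ≈⟨ solve 3 (λ t y h → t :* (con 1 :+ y :* h) := t :+ t :* (y :* h)) ≈-refl (T j) (X^ (k * j)) (G (k * j)) ⟩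
      T j ⊕ T j ⊛ (X^ (k * j) ⊛ G (k * j))
        ≈⟨ ⊕-cong T≈𝟙⊕V (⊛-cong ≈-refl (≈-sym (P≈X^G (k * j) 1≤kj))) ⟩
      (𝟙 ⊕ V j) ⊕ T j ⊛ P (k * j)
        ≈⟨ solve 3 (λ v t p → (con 1 :+ v) :+ t :* p := con 1 :+ (v :+ t :* p)) ≈-refl (V j) (T j) (P (k * j)) ⟩
      𝟙 ⊕ (V j ⊕ T j ⊛ P (k * j))  ∎)))

    Qfrom : ℕ → Series
    Qfrom a = profile j (λ c → 𝕀 ((a + c) % k ≟ 1))

    Qfrom-unfold : ∀ a → Qfrom a ≈ constant (𝕀 (a % k ≟ 1)) ⊕ X^ j ⊛ Qfrom (suc a)
    Qfrom-unfold a = ≈-trans (profile-unfold j 1≤j _)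
      (⊕-cong (ext λ z → cong (λ v → constant (𝕀 (v % k ≟ 1)) z) (+-identityʳ a))
              (⊛-cong ≈-refl (profile-cong j _ _ (λ c → cong (λ v → 𝕀 (v % k ≟ 1)) (+-suc a c)))))

    Qfrom-skip : ∀ d a → (∀ e → e < d → 𝕀 ((a + e) % k ≟ 1) ≡ 0) →
                 Qfrom a ≈ X^ (d * j) ⊛ Qfrom (a + d)
    Qfrom-skip zero a _ = begin
      Qfrom a             ≈⟨ ≈-sym (Laws.*-identityˡ _) ⟩
      𝟙 ⊛ Qfrom a         ≈⟨ ⊛-cong (≈-sym X^0≈𝟙) (ext λ x → cong (λ v → Qfrom v x) (≡.sym (+-identityʳ a))) ⟩
      X^ 0 ⊛ Qfrom (a + 0) ∎
    Qfrom-skip (suc d) a zeros = begin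
      Qfrom a                                    ≈⟨ Qfrom-unfold a ⟩
      constant (𝕀 (a % k ≟ 1)) ⊕ X^ j ⊛ Qfrom (suc a)
        ≈⟨ ⊕-cong (ext λ z → cong (λ v → constant v z)
             (≡.trans (cong (λ v → 𝕀 (v % k ≟ 1)) (≡.sym (+-identityʳ a))) (zeros 0 (s≤s z≤n)))) ≈-refl ⟩
      constant 0 ⊕ X^ j ⊛ Qfrom (suc a)          ≈⟨ constant-0 _ ⟩
      X^ j ⊛ Qfrom (suc a)
        ≈⟨ ⊛-cong ≈-refl (Qfrom-skip d (suc a) (λ e e<d →
             ≡.trans (cong (λ v → 𝕀 (v % k ≟ 1)) (≡.sym (+-suc a e))) (zeros (suc e) (s≤s e<d)))) ⟩
      X^ j ⊛ (X^ (d * j) ⊛ Qfrom (suc a + d))    ≈⟨ Laws.*-assoc _ _ _ ⟨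
      X^ j ⊛ X^ (d * j) ⊛ Qfrom (suc a + d)
        ≈⟨ ⊛-cong (X^-+ j (d * j)) (ext λ x → cong (λ v → Qfrom v x) (≡.sym (+-suc a d))) ⟩
      X^ (j + d * j) ⊛ Qfrom (a + suc d)         ∎

    -- Qfrom 1 = 1 + q^(kj) · Qfrom 1, the recursion of G (k j)
    Qfrom1≈G : Qfrom 1 ≈ G (k * j)
    Qfrom1≈G = unique-fixpoint (k * j) 1≤kj 𝟙 (Qfrom 1) (G (k * j)) (begin
      Qfrom 1                                   ≈⟨ Qfrom-unfold 1 ⟩
      constant 1 ⊕ x ⊛ Qfrom 2                  ≈⟨ constant-1 _ ⟩
      𝟙 ⊕ x ⊛ Qfrom 2                           ≈⟨ ⊕-cong ≈-refl (⊛-cong ≈-refl (Qfrom-skip k' 2 not-one)) ⟩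
      𝟙 ⊕ x ⊛ (X^ (k' * j) ⊛ Qfrom (2 + k'))    ≈⟨ ⊕-cong ≈-refl (⊛-cong ≈-refl (⊛-cong ≈-refl wrap)) ⟩
      𝟙 ⊕ x ⊛ (X^ (k' * j) ⊛ (x ⊛ Qfrom 1))
        ≈⟨ ⊕-cong ≈-refl (solve 3 (λ x p z → x :* (p :* (x :* z)) := (x :* (x :* p)) :* z) ≈-refl x (X^ (k' * j)) (Qfrom 1)) ⟩
      𝟙 ⊕ (x ⊛ (x ⊛ X^ (k' * j))) ⊛ Qfrom 1
        ≈⟨ ⊕-cong ≈-refl (⊛-cong (≈-trans (⊛-cong ≈-refl (X^-+ j (k' * j))) (X^-+ j (j + k' * j))) ≈-refl) ⟩
      𝟙 ⊕ X^ (k * j) ⊛ Qfrom 1                  ∎) (G-unfold (k * j) 1≤kj)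
      where
      x : Series
      x = X^ j
      not-one : ∀ e → e < k' → 𝕀 ((2 + e) % k ≟ 1) ≡ 0
      not-one e e<k' = 𝕀-no ((2 + e) % k ≟ 1)
        (λ eq → 1+n≢0 (suc-injective (≡.trans (≡.sym (m<n⇒m%n≡m (s≤s (s≤s e<k')))) eq)))
      -- residues repeat with period k
      wrap : Qfrom (2 + k') ≈ x ⊛ Qfrom 1
      wrap = ≈-trans (profile-cong j _ _ (λ c → cong (λ v → 𝕀 (v ≟ 1))
                       (≡.trans (cong (_% k) (+-comm k c)) ([m+n]%n≡m%n c k))))
                     (≈-trans (Qfrom-unfold 0) (constant-0 _))

    -- multiplicities 1, k + 1, 2k + 1, …
    Q≈X^G : Q j ≈ X^ j ⊛ G (k * j)
    Q≈X^G = ≈-trans (≈-trans (Qfrom-unfold 0) (constant-0 _)) (⊛-cong ≈-refl Qfrom1≈G)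

    -- q^j/(1-q^j) = T j · q^j/(1-q^(kj)): positive multiplicities of j, split
    -- into a part < k and a part ≡ 1 (mod k)
    P≈T⊛Q : P j ≈ T j ⊛ Q j
    P≈T⊛Q = begin
      P j                        ≈⟨ P≈X^G j 1≤j ⟩
      X^ j ⊛ G j                 ≈⟨ ⊛-cong ≈-refl glaisher-factor ⟩
      X^ j ⊛ (T j ⊛ G (k * j))   ≈⟨ solve 3 (λ x t h → x :* (t :* h) := t :* (x :* h)) ≈-refl (X^ j) (T j) (G (k * j)) ⟩
      T j ⊛ (X^ j ⊛ G (k * j))   ≈⟨ ⊛-cong ≈-refl (≈-sym Q≈X^G) ⟩
      T j ⊛ Q j                  ∎

-- Products (or sums) of per-size factors over the sizes m ≤ L divisible by k
-- agree, up to degree L, with those over the multiples k·a with a ≤ L.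
module Truncation (k' : ℕ) where

  open import Data.Nat using (ℕ; zero; suc; _+_; _*_; _∸_; _≤_; _<_; z≤n; s≤s; _%_; _/_)
  open import Data.Nat.Properties
  open import Data.Nat.DivMod using (m<n⇒m%n≡m; [m+kn]%n≡m%n; m≡m%n+[m/n]*n; m%n<n; m/n≤m)
  open import Data.Nat.Divisibility using (_∣_; _∣?_; n∣m⇒m%n≡0; n∣m*n)
  open import Relation.Binary.PropositionalEquality
  open import Relation.Nullary using (Dec; yes; no; ¬_; does)
  open import Data.Empty using (⊥-elim)
  open import Data.Bool using (if_then_else_)
  open FormalSeries
  open Profiles
  open Truncated
  open PartSize k' using (k)

  select : ∀ {p} {P : Set p} → Dec P → Series → Series → Series
  select d f g = if does d then f else g

  select-elim : ∀ {p} {P : Set p} (d : Dec P) {f g h} →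
                (P → f ≈ h) → (¬ P → g ≈ h) → select d f g ≈ h
  select-elim (yes p) yes-case no-case = yes-case p
  select-elim (no ¬p) yes-case no-case = no-case ¬p

  profile-low : ∀ N m a → N < m → profile m a ≈[ N ] constant (a 0)
  profile-low N m a N<m x x≤N = begin
    profile m a x                                        ≡⟨ at (profile-unfold m 1≤m a) x ⟩
    (constant (a 0) ⊕ X^ m ⊛ profile m (λ c → a (suc c))) x ≡⟨ ⊕-def _ _ x ⟩
    constant (a 0) x + (X^ m ⊛ profile m (λ c → a (suc c))) x
      ≡⟨ cong (_+_ (constant (a 0) x)) (trans (X^-⊛ m _ x) (when-no (m ≤? x) _ (<⇒≱ (≤-<-trans x≤N N<m)))) ⟩
    constant (a 0) x + 0                                 ≡⟨ +-identityʳ _ ⟩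
    constant (a 0) x                                     ∎
    where
    open ≡-Reasoning
    1≤m : 1 ≤ m
    1≤m = ≤-trans (s≤s z≤n) N<m

  not-multiple : ∀ r a → suc r < k → ¬ (k ∣ suc r + a * k)
  not-multiple r a r<k k∣ = 1+n≢0 (trans (sym (m<n⇒m%n≡m r<k))
                        (trans (sym ([m+kn]%n≡m%n (suc r) a k)) (n∣m⇒m%n≡0 _ k k∣)))

  -- op is ⊛ or ⊕ with neutral element e; F m is the factor of size m,
  -- which is trivial up to degree N whenever m > N
  module OverMultiples (op : Series → Series → Series) (e : Series) (F : ℕ → Series)
    (op-upTo : ∀ N {a a' b b'} → a ≈[ N ] a' → b ≈[ N ] b' → op a b ≈[ N ] op a' b')
    (op-cong : ∀ {a a' b b'} → a ≈ a' → b ≈ b' → op a b ≈ op a' b')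
    (op-identityˡ : ∀ f → op e f ≈ f)
    (F-low : ∀ N m → N < m → F m ≈[ N ] e) where

    overDivisible : ℕ → Series
    overDivisible zero = e
    overDivisible (suc L) = op (select (k ∣? suc L) (F (suc L)) e) (overDivisible L)

    overMultiples : ℕ → Series
    overMultiples zero = e
    overMultiples (suc a) = op (F (k * suc a)) (overMultiples a)

    -- exactly: the divisible sizes up to r + a·k (r < k) are k, 2k, …, a·k
    divisible≈multiples : ∀ a r → r ≤ suc k' → overDivisible (r + a * k) ≈ overMultiples a
    divisible≈multiples zero zero _ = ≈-refl
    divisible≈multiples (suc a) zero _ =
      op-cong (select-elim (k ∣? suc (suc k' + a * k))
                (λ _ → ext λ x → cong (λ v → F v x) (sym (trans (*-suc k a) (cong (_+_ k) (*-comm k a)))))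
                (λ k∤ka → ⊥-elim (k∤ka (n∣m*n (suc a)))))
              (divisible≈multiples a (suc k') ≤-refl)
    divisible≈multiples a (suc r) r<k = ≈-trans
      (op-cong (select-elim (k ∣? suc (r + a * k)) (λ k∣ → ⊥-elim (not-multiple r a (s≤s r<k) k∣)) (λ _ → ≈-refl)) ≈-refl)
      (≈-trans (op-identityˡ _) (divisible≈multiples a r (≤-trans (n≤1+n r) r<k)))

    multiples-stable : ∀ a d N → N < k * suc a → overMultiples (d + a) ≈[ N ] overMultiples a
    multiples-stable a zero N N< = λ _ _ → refl
    multiples-stable a (suc d) N N< = ≈[]-trans N
      (op-upTo N (F-low N (k * suc (d + a)) (<-≤-trans N< (*-monoʳ-≤ k (s≤s (m≤n+m a d)))))
                 (multiples-stable a d N N<))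
      (≈⇒≈[ N ] (op-identityˡ (overMultiples a)))

    -- write L = r + a·k: the divisible sizes are k, …, a·k, and the further
    -- multiples up to k·L exceed L
    overDivisible≈overMultiples : ∀ L → overDivisible L ≈[ L ] overMultiples L
    overDivisible≈overMultiples L = ≈[]-trans L
      (≈⇒≈[ L ] (≈-trans (ext λ x → cong (λ v → overDivisible v x) (m≡m%n+[m/n]*n L k))
                         (divisible≈multiples a r (≤-pred (m%n<n L k)))))
      (≈[]-sym L (subst (λ v → overMultiples v ≈[ L ] overMultiples a) (m∸n+n≡m (m/n≤m L k))
                        (multiples-stable a (L ∸ a) L L<k[a+1])))
      where
      a r : ℕ
      a = L / k
      r = L % k
      L<k[a+1] : L < k * suc a
      L<k[a+1] = begin-strict
        L             ≡⟨ m≡m%n+[m/n]*n L k ⟩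
        r + a * k     <⟨ +-monoˡ-< (a * k) (m%n<n L k) ⟩
        k + a * k     ≡⟨ cong (_+_ k) (*-comm a k) ⟩
        k + k * a     ≡⟨ *-suc k a ⟨
        k * suc a     ∎
        where open ≤-Reasoning

-- The generating series of the statistics over partitions with parts ≤ L,
-- defined by adding the part size L + 1 with all its multiplicities, and
-- their closed forms as products and sums of per-size factors.
module GeneratingSeries (k' : ℕ) where

  open import Data.Nat using (ℕ; zero; suc; _*_; _∸_; _≤_; _<_; z≤n; s≤s; _%_)
  open import Data.Nat.Properties
  open import Data.Nat.Divisibility using (_∣_; _∣?_; n∣m⇒m%n≡0)
  open import Relation.Binary.PropositionalEquality as ≡ using (_≡_; refl; cong)
  open import Relation.Nullary using (Dec; yes; no)
  open import Data.Empty using (⊥-elim)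
  open FormalSeries
  open Profiles
  open Truncated
  open GeometricProfiles
  open PartSize k'
  open Truncation k'
  open import Relation.Binary.Reasoning.Setoid setoid
  open SeriesSolver using (solve; _:+_; _:*_; _:=_; con)

  -- weights of c copies of the size m:
  -- usesDivisible: m occurs and is divisible by k;
  -- regularMult: allowed in a k-regular partition;
  -- oneModParts: number of those parts ≡ 1 (mod k), if allowed
  usesDivisible regularMult oneModParts : ℕ → ℕ → ℕ
  usesDivisible m c = 𝕀 (1 ≤? c) * 𝕀 (k ∣? m)
  regularMult m c = 1 ∸ usesDivisible m c
  oneModParts m c = regularMult m c * (c * 𝕀 (m % k ≟ 1 % k))

  -- Over partitions with parts ≤ L:
  -- Regular: k-regular ones; OneDivisible: exactly one size divisible by k;
  -- Restricted: all multiplicities < k; OneRepeated: exactly one size with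
  -- multiplicity ≥ k; SumA / SumB: the statistics defining A and B.
  Regular OneDivisible Restricted OneRepeated SumA SumB : ℕ → Series
  Regular zero = 𝟙
  Regular (suc L) = profile (suc L) (regularMult (suc L)) ⊛ Regular L
  OneDivisible zero = 𝟘
  OneDivisible (suc L) = profile (suc L) (usesDivisible (suc L)) ⊛ Regular L
                       ⊕ profile (suc L) (regularMult (suc L)) ⊛ OneDivisible L
  Restricted zero = 𝟙
  Restricted (suc L) = T (suc L) ⊛ Restricted L
  OneRepeated zero = 𝟘
  OneRepeated (suc L) = U (suc L) ⊛ Restricted L ⊕ T (suc L) ⊛ OneRepeated L
  SumA zero = 𝟘
  SumA (suc L) = profile (suc L) (oneModParts (suc L)) ⊛ Regular L
               ⊕ profile (suc L) (regularMult (suc L)) ⊛ SumA L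
  SumB zero = 𝟘
  SumB (suc L) = V (suc L) ⊛ Restricted L ⊕ T (suc L) ⊛ SumB L

  R Pdiv Gdiv Pone : ℕ → Series
  R m = select (k ∣? m) 𝟙 (G m)
  Pdiv m = select (k ∣? m) (P m) 𝟘
  Gdiv m = select (k ∣? m) (G m) 𝟙
  Pone m = select (m % k ≟ 1) (P m) 𝟘

  SumPone SumQ ProdG : ℕ → Series
  SumPone zero = 𝟘
  SumPone (suc L) = Pone (suc L) ⊕ SumPone L
  SumQ zero = 𝟘
  SumQ (suc L) = Q (suc L) ⊕ SumQ L
  ProdG zero = 𝟙
  ProdG (suc L) = G (suc L) ⊛ ProdG L

  -- Σ_(k∣m) P m versus Σ_a P (k a), and ∏_(k∣m) G m versus ∏_a G (k a)
  module ΣP = OverMultiples _⊕_ 𝟘 P ⊕-upTo ⊕-cong Laws.+-identityˡ (λ N m N<m → profile-low N m _ N<m)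
  module ΠG = OverMultiples _⊛_ 𝟙 G ⊛-upTo ⊛-cong Laws.*-identityˡ
    (λ N m N<m x x≤N → ≡.trans (profile-low N m _ N<m x x≤N) (+-identityʳ (𝟙 x)))

  profile-single : ∀ m → 1 ≤ m → ∀ a → a 0 ≡ 1 → (∀ c → a (suc c) ≡ 0) → profile m a ≈ 𝟙
  profile-single m 1≤m a a0 a+ = begin
    profile m a                                ≈⟨ profile-unfold m 1≤m a ⟩
    constant (a 0) ⊕ X^ m ⊛ profile m (λ c → a (suc c))
      ≈⟨ ⊕-cong (ext λ x → cong (λ v → constant v x) a0) (⊛-cong ≈-refl (≈-trans (profile-cong m _ _ a+) (profile-zero m))) ⟩
    constant 1 ⊕ X^ m ⊛ 𝟘                      ≈⟨ constant-1 _ ⟩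
    𝟙 ⊕ X^ m ⊛ 𝟘                               ≈⟨ solve 1 (λ x → con 1 :+ x :* con 0 := con 1) ≈-refl (X^ m) ⟩
    𝟙                                          ∎

  module SizeFactors (m : ℕ) (1≤m : 1 ≤ m) where

    regular-factor : profile m (regularMult m) ≈ R m
    regular-factor = by-cases (k ∣? m)
      where
      by-cases : (d : Dec (k ∣ m)) →
        profile m (λ c → 1 ∸ 𝕀 (1 ≤? c) * 𝕀 d) ≈ select d 𝟙 (G m)
      by-cases (yes _) = profile-single m 1≤m _ refl (λ c → refl)
      by-cases (no _) = profile-cong m _ _ (λ c → cong (1 ∸_) (*-zeroʳ (𝕀 (1 ≤? c))))

    divisible-factor : profile m (usesDivisible m) ≈ Pdiv m
    divisible-factor = by-cases (k ∣? m)
      where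
      by-cases : (d : Dec (k ∣ m)) → profile m (λ c → 𝕀 (1 ≤? c) * 𝕀 d) ≈ select d (P m) 𝟘
      by-cases (yes _) = profile-cong m _ _ (λ c → *-identityʳ _)
      by-cases (no _) = ≈-trans (profile-cong m _ _ (λ c → *-zeroʳ (𝕀 (1 ≤? c)))) (profile-zero m)

    divisible-absorbs : Pdiv m ⊛ R m ≈ Pdiv m
    divisible-absorbs = by-cases (k ∣? m)
      where
      by-cases : (d : Dec (k ∣ m)) → select d (P m) 𝟘 ⊛ select d 𝟙 (G m) ≈ select d (P m) 𝟘
      by-cases (yes _) = Laws.*-identityʳ _
      by-cases (no _) = Laws.zeroˡ _

    G≈R⊛Gdiv : G m ≈ R m ⊛ Gdiv m
    G≈R⊛Gdiv = by-cases (k ∣? m)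
      where
      by-cases : (d : Dec (k ∣ m)) → G m ≈ select d 𝟙 (G m) ⊛ select d (G m) 𝟙
      by-cases (yes _) = ≈-sym (Laws.*-identityˡ _)
      by-cases (no _) = ≈-sym (Laws.*-identityʳ _)

    -- a size ≡ 1 (mod k) is never divisible by k; then Σ_c c q^(cm) = P m ⊛ G m
    oneMod-factor : profile m (oneModParts m) ≈ Pone m ⊛ R m
    oneMod-factor = by-cases (k ∣? m) (m % k ≟ 1)
      where
      by-cases : (d : Dec (k ∣ m)) (e : Dec (m % k ≡ 1)) →
        profile m (λ c → (1 ∸ 𝕀 (1 ≤? c) * 𝕀 d) * (c * 𝕀 e)) ≈ select e (P m) 𝟘 ⊛ select d 𝟙 (G m)
      by-cases (yes k∣m) (yes m≡1) = ⊥-elim (1+n≢0 (≡.trans (≡.sym m≡1) (n∣m⇒m%n≡0 m k k∣m)))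
      by-cases (no _) (yes _) = ≈-trans
        (profile-cong m _ _ (λ c → ≡.trans (≡.cong₂ _*_ (cong (1 ∸_) (*-zeroʳ (𝕀 (1 ≤? c)))) (*-identityʳ c)) (*-identityˡ c)))
        (W≈P⊛G m 1≤m)
      by-cases d (no _) = ≈-trans
        (profile-cong m _ _ (λ c → ≡.trans (cong ((1 ∸ 𝕀 (1 ≤? c) * 𝕀 d) *_) (*-zeroʳ c)) (*-zeroʳ (1 ∸ 𝕀 (1 ≤? c) * 𝕀 d))))
        (≈-trans (profile-zero m) (≈-sym (Laws.zeroˡ _)))

  OneDivisible-closed : ∀ L → OneDivisible L ≈ ΣP.overDivisible L ⊛ Regular L
  OneDivisible-closed zero = ≈-sym (Laws.zeroˡ _)
  OneDivisible-closed (suc L) = begin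
    profile m (usesDivisible m) ⊛ Regular L ⊕ profile m (regularMult m) ⊛ OneDivisible L
      ≈⟨ ⊕-cong (⊛-cong divisible-factor ≈-refl) (⊛-cong regular-factor (OneDivisible-closed L)) ⟩
    Pdiv m ⊛ Regular L ⊕ R m ⊛ (ΣP.overDivisible L ⊛ Regular L)
      ≈⟨ ⊕-cong (⊛-cong (≈-sym divisible-absorbs) ≈-refl) ≈-refl ⟩
    (Pdiv m ⊛ R m) ⊛ Regular L ⊕ R m ⊛ (ΣP.overDivisible L ⊛ Regular L)
      ≈⟨ solve 4 (λ e r n s → (e :* r) :* n :+ r :* (s :* n) := (e :+ s) :* (r :* n)) ≈-refl
               (Pdiv m) (R m) (Regular L) (ΣP.overDivisible L) ⟩
    (Pdiv m ⊕ ΣP.overDivisible L) ⊛ (R m ⊛ Regular L)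
      ≈⟨ ⊛-cong ≈-refl (⊛-cong (≈-sym regular-factor) ≈-refl) ⟩
    (Pdiv m ⊕ ΣP.overDivisible L) ⊛ (profile m (regularMult m) ⊛ Regular L) ∎
    where
    m = suc L
    open SizeFactors m (s≤s z≤n)

  SumA-closed : ∀ L → SumA L ≈ SumPone L ⊛ Regular L
  SumA-closed zero = ≈-sym (Laws.zeroˡ _)
  SumA-closed (suc L) = begin
    profile m (oneModParts m) ⊛ Regular L ⊕ profile m (regularMult m) ⊛ SumA L
      ≈⟨ ⊕-cong (⊛-cong oneMod-factor ≈-refl) (⊛-cong regular-factor (SumA-closed L)) ⟩
    (Pone m ⊛ R m) ⊛ Regular L ⊕ R m ⊛ (SumPone L ⊛ Regular L)
      ≈⟨ solve 4 (λ e r n s → (e :* r) :* n :+ r :* (s :* n) := (e :+ s) :* (r :* n)) ≈-refl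
               (Pone m) (R m) (Regular L) (SumPone L) ⟩
    (Pone m ⊕ SumPone L) ⊛ (R m ⊛ Regular L)
      ≈⟨ ⊛-cong ≈-refl (⊛-cong (≈-sym regular-factor) ≈-refl) ⟩
    (Pone m ⊕ SumPone L) ⊛ (profile m (regularMult m) ⊛ Regular L) ∎
    where
    m = suc L
    open SizeFactors m (s≤s z≤n)

  OneRepeated-closed : ∀ L → OneRepeated L ≈ ΣP.overMultiples L ⊛ Restricted L
  OneRepeated-closed zero = ≈-sym (Laws.zeroˡ _)
  OneRepeated-closed (suc L) = begin
    U m ⊛ Restricted L ⊕ T m ⊛ OneRepeated L
      ≈⟨ ⊕-cong (⊛-cong (U≈T⊛P m (s≤s z≤n)) ≈-refl) (⊛-cong ≈-refl (OneRepeated-closed L)) ⟩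
    (T m ⊛ P (k * m)) ⊛ Restricted L ⊕ T m ⊛ (ΣP.overMultiples L ⊛ Restricted L)
      ≈⟨ solve 4 (λ t p n s → (t :* p) :* n :+ t :* (s :* n) := (p :+ s) :* (t :* n)) ≈-refl
               (T m) (P (k * m)) (Restricted L) (ΣP.overMultiples L) ⟩
    (P (k * m) ⊕ ΣP.overMultiples L) ⊛ (T m ⊛ Restricted L) ∎
    where m = suc L

  SumB⊕OneRepeated-closed : ∀ L → SumB L ⊕ OneRepeated L ≈ SumQ L ⊛ Restricted L
  SumB⊕OneRepeated-closed zero = solve 0 (con 0 :+ con 0 := con 0 :* con 1) ≈-refl
  SumB⊕OneRepeated-closed (suc L) = begin
    (V m ⊛ Restricted L ⊕ T m ⊛ SumB L) ⊕ (U m ⊛ Restricted L ⊕ T m ⊛ OneRepeated L)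
      ≈⟨ solve 6 (λ v n t b u d → (v :* n :+ t :* b) :+ (u :* n :+ t :* d) := (v :+ u) :* n :+ t :* (b :+ d)) ≈-refl
               (V m) (Restricted L) (T m) (SumB L) (U m) (OneRepeated L) ⟩
    (V m ⊕ U m) ⊛ Restricted L ⊕ T m ⊛ (SumB L ⊕ OneRepeated L)
      ≈⟨ ⊕-cong (⊛-cong (≈-trans (V⊕U≈P m (s≤s z≤n)) (P≈T⊛Q m (s≤s z≤n))) ≈-refl)
                (⊛-cong ≈-refl (SumB⊕OneRepeated-closed L)) ⟩
    (T m ⊛ Q m) ⊛ Restricted L ⊕ T m ⊛ (SumQ L ⊛ Restricted L)
      ≈⟨ solve 4 (λ t p n s → (t :* p) :* n :+ t :* (s :* n) := (p :+ s) :* (t :* n)) ≈-refl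
               (T m) (Q m) (Restricted L) (SumQ L) ⟩
    (Q m ⊕ SumQ L) ⊛ (T m ⊛ Restricted L) ∎
    where m = suc L

  ProdG-regular : ∀ L → ProdG L ≈ Regular L ⊛ ΠG.overDivisible L
  ProdG-regular zero = ≈-sym (Laws.*-identityˡ _)
  ProdG-regular (suc L) = begin
    G m ⊛ ProdG L
      ≈⟨ ⊛-cong G≈R⊛Gdiv (ProdG-regular L) ⟩
    (R m ⊛ Gdiv m) ⊛ (Regular L ⊛ ΠG.overDivisible L)
      ≈⟨ solve 4 (λ r f n c → (r :* f) :* (n :* c) := (r :* n) :* (f :* c)) ≈-refl
               (R m) (Gdiv m) (Regular L) (ΠG.overDivisible L) ⟩
    (R m ⊛ Regular L) ⊛ (Gdiv m ⊛ ΠG.overDivisible L)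
      ≈⟨ ⊛-cong (⊛-cong (≈-sym regular-factor) ≈-refl) ≈-refl ⟩
    (profile m (regularMult m) ⊛ Regular L) ⊛ (Gdiv m ⊛ ΠG.overDivisible L) ∎
    where
    m = suc L
    open SizeFactors m (s≤s z≤n)

  ProdG-restricted : ∀ L → ProdG L ≈ Restricted L ⊛ ΠG.overMultiples L
  ProdG-restricted zero = ≈-sym (Laws.*-identityˡ _)
  ProdG-restricted (suc L) = begin
    G m ⊛ ProdG L
      ≈⟨ ⊛-cong (glaisher-factor m (s≤s z≤n)) (ProdG-restricted L) ⟩
    (T m ⊛ G (k * m)) ⊛ (Restricted L ⊛ ΠG.overMultiples L)
      ≈⟨ solve 4 (λ r f n c → (r :* f) :* (n :* c) := (r :* n) :* (f :* c)) ≈-refl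
               (T m) (G (k * m)) (Restricted L) (ΠG.overMultiples L) ⟩
    (T m ⊛ Restricted L) ⊛ (G (k * m) ⊛ ΠG.overMultiples L) ∎
    where m = suc L

module KeyIdentities (k' : ℕ) where

  open import Data.Nat using (ℕ; zero; suc; _+_; _*_; _≤_; z≤n; s≤s; _%_)
  open import Data.Nat.Properties
  open import Data.Nat.Divisibility using (_∣_; _∣?_)
  open import Relation.Binary.PropositionalEquality
  open import Relation.Nullary using (Dec; yes; no)
  open import Algebra.Properties.CommutativeSemigroup +-commutativeSemigroup using (interchange)
  open FormalSeries
  open Profiles
  open Truncated
  open GeometricProfiles using (P; G)
  open PartSize k' using (k; Q)
  open Truncation k' using (select)
  open GeneratingSeries k'

  overDivisible-constant : ∀ L → ΠG.overDivisible L 0 ≡ 1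
  overDivisible-constant zero = refl
  overDivisible-constant (suc L) =
    trans (⊛-0 _ _) (cong₂ _*_ (factor (k ∣? suc L)) (overDivisible-constant L))
    where
    factor : (d : Dec (k ∣ suc L)) → select d (G (suc L)) 𝟙 0 ≡ 1
    factor (yes _) = refl
    factor (no _) = refl

  -- cancel ∏_(k∣m) G m ≈[L] ∏_a G (k a), which has constant term 1
  glaisher : ∀ L → Regular L ≈[ L ] Restricted L
  glaisher L = cancel-upTo (ΠG.overDivisible L) (overDivisible-constant L) (Regular L) (Restricted L) L
    (≈[]-trans L (≈⇒≈[ L ] (≈-trans (≈-sym (ProdG-regular L)) (ProdG-restricted L)))
                 (⊛-upTo L (λ _ _ → refl) (≈[]-sym L (ΠG.overDivisible≈overMultiples L))))

  sumFrom1 : ℕ → (ℕ → ℕ) → ℕ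
  sumFrom1 zero F = 0
  sumFrom1 (suc L) F = F (suc L) + sumFrom1 L F

  sumFrom1-cong : ∀ L (F F′ : ℕ → ℕ) → (∀ i → 1 ≤ i → i ≤ L → F i ≡ F′ i) → sumFrom1 L F ≡ sumFrom1 L F′
  sumFrom1-cong zero F F′ e = refl
  sumFrom1-cong (suc L) F F′ e =
    cong₂ _+_ (e (suc L) (s≤s z≤n) ≤-refl) (sumFrom1-cong L F F′ (λ i p q → e i p (m≤n⇒m≤1+n q)))

  sumFrom1-+ : ∀ L (F F′ : ℕ → ℕ) → sumFrom1 L (λ i → F i + F′ i) ≡ sumFrom1 L F + sumFrom1 L F′
  sumFrom1-+ zero F F′ = refl
  sumFrom1-+ (suc L) F F′ rewrite sumFrom1-+ L F F′ = interchange (F (suc L)) (F′ (suc L)) _ _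

  sumFrom1-* : ∀ L c (F : ℕ → ℕ) → sumFrom1 L (λ i → c * F i) ≡ c * sumFrom1 L F
  sumFrom1-* zero c F = sym (*-zeroʳ c)
  sumFrom1-* (suc L) c F rewrite sumFrom1-* L c F = sym (*-distribˡ-+ c (F (suc L)) (sumFrom1 L F))

  sumFrom1-zeros : ∀ M → sumFrom1 M (λ _ → 0) ≡ 0
  sumFrom1-zeros zero = refl
  sumFrom1-zeros (suc M) = sumFrom1-zeros M

  sumFrom1-swap : ∀ L M (F : ℕ → ℕ → ℕ) →
                  sumFrom1 L (λ j → sumFrom1 M (F j)) ≡ sumFrom1 M (λ c → sumFrom1 L (λ j → F j c))
  sumFrom1-swap zero M F = sym (sumFrom1-zeros M)
  sumFrom1-swap (suc L) M F rewrite sumFrom1-swap L M F = sym (sumFrom1-+ M (F (suc L)) _)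

  sumTo≡head+sumFrom1 : ∀ (h : ℕ → ℕ) x → sumTo h x ≡ h 0 + sumFrom1 x h
  sumTo≡head+sumFrom1 h zero = sym (+-identityʳ (h 0))
  sumTo≡head+sumFrom1 h (suc x) = begin
    sumTo h (suc x)                    ≡⟨ sumTo-last h x ⟩
    sumTo h x + h (suc x)              ≡⟨ cong (_+ h (suc x)) (sumTo≡head+sumFrom1 h x) ⟩
    h 0 + sumFrom1 x h + h (suc x)     ≡⟨ +-assoc (h 0) _ _ ⟩
    h 0 + (sumFrom1 x h + h (suc x))   ≡⟨ cong (_+_ (h 0)) (+-comm (sumFrom1 x h) (h (suc x))) ⟩
    h 0 + sumFrom1 (suc x) h           ∎
    where open ≡-Reasoning

  profile-coeff : ∀ L x j (a : ℕ → ℕ) → 1 ≤ j → x ≤ L → a 0 ≡ 0 →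
                  profile j a x ≡ sumFrom1 L (λ c → 𝕀 (c * j ≟ x) * a c)
  profile-coeff L x j a 1≤j x≤L a0 = begin
    profile j a x                   ≡⟨ sym (profile-range j 1≤j a x L x≤L) ⟩
    sumTo h L                       ≡⟨ sumTo≡head+sumFrom1 h L ⟩
    h 0 + sumFrom1 L h              ≡⟨ cong (λ v → 𝕀 (0 ≟ x) * v + sumFrom1 L h) a0 ⟩
    𝕀 (0 ≟ x) * 0 + sumFrom1 L h    ≡⟨ cong (_+ sumFrom1 L h) (*-zeroʳ (𝕀 (0 ≟ x))) ⟩
    sumFrom1 L h                    ∎
    where
    open ≡-Reasoning
    h : ℕ → ℕ
    h c = 𝕀 (c * j ≟ x) * a c

  SumPone-coeff : ∀ L x → SumPone L x ≡ sumFrom1 L (λ r → 𝕀 (r % k ≟ 1) * P r x)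
  SumPone-coeff zero x = refl
  SumPone-coeff (suc L) x = trans (⊕-def _ _ x) (cong₂ _+_ (term (suc L % k ≟ 1)) (SumPone-coeff L x))
    where
    term : (d : Dec (suc L % k ≡ 1)) → select d (P (suc L)) 𝟘 x ≡ 𝕀 d * P (suc L) x
    term (yes _) = sym (+-identityʳ _)
    term (no _) = refl

  SumQ-coeff : ∀ L x → SumQ L x ≡ sumFrom1 L (λ j → Q j x)
  SumQ-coeff zero x = refl
  SumQ-coeff (suc L) x = trans (⊕-def _ _ x) (cong (_+_ (Q (suc L) x)) (SumQ-coeff L x))

  -- both sides count the pairs (r, c), 1 ≤ r, c ≤ L, with r·c = x and r ≡ 1 (mod k)
  divisor : ∀ L → SumPone L ≈[ L ] SumQ L
  divisor L x x≤L = begin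
    SumPone L x
      ≡⟨ SumPone-coeff L x ⟩
    sumFrom1 L (λ r → 𝕀 (r % k ≟ 1) * P r x)
      ≡⟨ sumFrom1-cong L _ _ (λ r 1≤r _ → cong (𝕀 (r % k ≟ 1) *_) (profile-coeff L x r _ 1≤r x≤L refl)) ⟩
    sumFrom1 L (λ r → 𝕀 (r % k ≟ 1) * sumFrom1 L (λ c → 𝕀 (c * r ≟ x) * 𝕀 (1 ≤? c)))
      ≡⟨ sumFrom1-cong L _ _ (λ r _ _ → sym (sumFrom1-* L (𝕀 (r % k ≟ 1)) _)) ⟩
    sumFrom1 L (λ r → sumFrom1 L (λ c → 𝕀 (r % k ≟ 1) * (𝕀 (c * r ≟ x) * 𝕀 (1 ≤? c))))
      ≡⟨ sumFrom1-cong L _ _ (λ r _ _ → sumFrom1-cong L _ _ (λ c 1≤c _ → pair r c 1≤c)) ⟩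
    sumFrom1 L (λ r → sumFrom1 L (λ c → 𝕀 (r * c ≟ x) * 𝕀 (r % k ≟ 1)))
      ≡⟨ sumFrom1-swap L L _ ⟩
    sumFrom1 L (λ c → sumFrom1 L (λ r → 𝕀 (r * c ≟ x) * 𝕀 (r % k ≟ 1)))
      ≡⟨ sumFrom1-cong L _ _ (λ j 1≤j _ → sym (profile-coeff L x j _ 1≤j x≤L refl)) ⟩
    sumFrom1 L (λ j → Q j x)
      ≡⟨ sym (SumQ-coeff L x) ⟩
    SumQ L x ∎
    where
    open ≡-Reasoning
    pair : ∀ r c → 1 ≤ c → 𝕀 (r % k ≟ 1) * (𝕀 (c * r ≟ x) * 𝕀 (1 ≤? c)) ≡ 𝕀 (r * c ≟ x) * 𝕀 (r % k ≟ 1)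
    pair r c 1≤c = begin
      𝕀 (r % k ≟ 1) * (𝕀 (c * r ≟ x) * 𝕀 (1 ≤? c)) ≡⟨ cong (λ v → 𝕀 (r % k ≟ 1) * (𝕀 (c * r ≟ x) * v)) (𝕀-yes (1 ≤? c) 1≤c) ⟩
      𝕀 (r % k ≟ 1) * (𝕀 (c * r ≟ x) * 1)           ≡⟨ cong (𝕀 (r % k ≟ 1) *_) (*-identityʳ _) ⟩
      𝕀 (r % k ≟ 1) * 𝕀 (c * r ≟ x)                 ≡⟨ *-comm (𝕀 (r % k ≟ 1)) _ ⟩
      𝕀 (c * r ≟ x) * 𝕀 (r % k ≟ 1)                 ≡⟨ cong (_* 𝕀 (r % k ≟ 1)) (𝕀-cong (c * r ≟ x) (r * c ≟ x)
                                                         (trans (*-comm r c)) (trans (*-comm c r))) ⟩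
      𝕀 (r * c ≟ x) * 𝕀 (r % k ≟ 1)                 ∎

  oneDivisible≡oneRepeated : ∀ n → OneDivisible n n ≡ OneRepeated n n
  oneDivisible≡oneRepeated n = begin
    OneDivisible n n                                ≡⟨ at (OneDivisible-closed n) n ⟩
    (ΣP.overDivisible n ⊛ Regular n) n             ≡⟨ ⊛-upTo n (ΣP.overDivisible≈overMultiples n) (glaisher n) n ≤-refl ⟩
    (ΣP.overMultiples n ⊛ Restricted n) n          ≡⟨ sym (at (OneRepeated-closed n) n) ⟩
    OneRepeated n n                                 ∎
    where open ≡-Reasoning

  sumA≡sumB+oneRepeated : ∀ n → SumA n n ≡ SumB n n + OneRepeated n n
  sumA≡sumB+oneRepeated n = begin
    SumA n n                                        ≡⟨ at (SumA-closed n) n ⟩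
    (SumPone n ⊛ Regular n) n                       ≡⟨ ⊛-upTo n (divisor n) (glaisher n) n ≤-refl ⟩
    (SumQ n ⊛ Restricted n) n                       ≡⟨ sym (at (SumB⊕OneRepeated-closed n) n) ⟩
    (SumB n ⊕ OneRepeated n) n                      ≡⟨ ⊕-def _ _ n ⟩
    SumB n n + OneRepeated n n                      ∎
    where open ≡-Reasoning

-- An explicit duplicate-free list of the partitions of n with parts ≤ L,
-- obtained by choosing the multiplicity of the largest admissible part.
module Enumeration where

  open import Data.Nat using (ℕ; zero; suc; _+_; _∸_; _≤_; _<_; _≥_; z≤n; s≤s)
  open import Data.Nat.Properties
  open import Data.Nat.ListAction using (sum)
  open import Data.List using (List; []; _∷_; _++_; map)
  open import Data.List.Relation.Unary.All using (All; []; _∷_)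
  import Data.List.Relation.Unary.All as All
  open import Data.List.Relation.Unary.Linked using (Linked; []; [-]; _∷_)
  import Data.List.Relation.Unary.Linked as Linked
  open import Data.List.Relation.Unary.Unique.Propositional using (Unique)
  import Data.List.Relation.Unary.Unique.Propositional.Properties as Unique
  open import Data.List.Relation.Unary.AllPairs using ([]; _∷_)
  open import Data.List.Relation.Binary.Disjoint.Propositional using (Disjoint)
  open import Data.List.Membership.Propositional using (_∈_)
  open import Data.List.Membership.Propositional.Properties using (∈-++⁻; ∈-++⁺ˡ; ∈-++⁺ʳ; ∈-map⁻; ∈-map⁺)
  open import Data.List.Relation.Unary.Any using (here)
  import Data.List.Properties as List
  open import Data.Product using (_×_; _,_)
  open import Data.Sum using (inj₁; inj₂)
  open import Relation.Binary.PropositionalEquality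
  open import Relation.Nullary using (Dec; yes; no; does)
  open import Data.Empty using (⊥-elim)
  open import Data.Bool using (if_then_else_)

  PartitionBelow : ℕ → ℕ → List ℕ → Set
  PartitionBelow L n μ = Linked _≥_ μ × All (0 <_) μ × sum μ ≡ n × All (_≤ L) μ

  keepIf : ∀ {p} {P : Set p} {A : Set} → Dec P → List A → List A
  keepIf d xs = if does d then xs else []

  keepIf-∈ : ∀ {p} {P : Set p} {A : Set} (d : Dec P) {xs : List A} {x} → x ∈ keepIf d xs → P × x ∈ xs
  keepIf-∈ (yes p) x∈ = p , x∈
  keepIf-∈ (no _) ()

  keepIf-yes : ∀ {p} {P : Set p} {A : Set} (d : Dec P) {xs : List A} {x} → P → x ∈ xs → x ∈ keepIf d xs
  keepIf-yes (yes _) _ x∈ = x∈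
  keepIf-yes (no ¬p) p _ = ⊥-elim (¬p p)

  -- partitions of n with parts < m (listed by `below`) and then those whose
  -- largest part is m, followed by a partition of n - m; f bounds the
  -- number of copies of m (fuel for termination)
  withLargest : ℕ → (ℕ → List (List ℕ)) → ℕ → ℕ → List (List ℕ)
  withLargest m below n zero = below n
  withLargest m below n (suc f) =
    below n ++ keepIf (m ≤? n) (map (m ∷_) (withLargest m below (n ∸ m) f))

  partitions : ℕ → ℕ → List (List ℕ)
  partitions zero zero = [] ∷ []
  partitions zero (suc n) = []
  partitions (suc L) n = withLargest (suc L) (partitions L) n n

  weaken : ∀ {L M n μ} → L ≤ M → PartitionBelow L n μ → PartitionBelow M n μ
  weaken L≤M (lk , pos , s , bd) = lk , pos , s , All.map (λ p → ≤-trans p L≤M) bd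

  cons-largest : ∀ m n μ → 1 ≤ m → m ≤ n → PartitionBelow m (n ∸ m) μ → PartitionBelow m n (m ∷ μ)
  cons-largest m n [] 1≤m m≤n (lk , pos , s , bd) =
    [-] , 1≤m ∷ pos , trans (cong (_+_ m) s) (m+[n∸m]≡n m≤n) , ≤-refl ∷ bd
  cons-largest m n (y ∷ ys) 1≤m m≤n (lk , pos , s , y≤m ∷ bd) =
    y≤m ∷ lk , 1≤m ∷ pos , trans (cong (_+_ m) s) (m+[n∸m]≡n m≤n) , ≤-refl ∷ y≤m ∷ bd

  bounded-by-head : ∀ {x xs} → Linked _≥_ (x ∷ xs) → All (_≤ x) xs
  bounded-by-head [-] = []
  bounded-by-head (y≤x ∷ lk) = y≤x ∷ All.map (λ p → ≤-trans p y≤x) (bounded-by-head lk)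

  drop-largest : ∀ {L n x xs} → PartitionBelow L n (x ∷ xs) → PartitionBelow x (n ∸ x) xs
  drop-largest {x = x} {xs} (lk , _ ∷ pos , s , _) =
    Linked.tail lk , pos , trans (sym (m+n∸m≡n x (sum xs))) (cong (_∸ x) s) , bounded-by-head lk

  partitions-sound : ∀ L n μ → μ ∈ partitions L n → PartitionBelow L n μ
  partitions-sound zero zero .[] (here refl) = [] , [] , refl , []
  partitions-sound zero (suc n) μ ()
  partitions-sound (suc L) n μ μ∈ = withLargest-sound n n μ μ∈
    where
    m = suc L
    withLargest-sound : ∀ f n μ → μ ∈ withLargest m (partitions L) n f → PartitionBelow m n μ
    withLargest-sound zero n μ μ∈ = weaken (n≤1+n L) (partitions-sound L n μ μ∈)
    withLargest-sound (suc f) n μ μ∈ with ∈-++⁻ (partitions L n) μ∈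
    ... | inj₁ μ∈below = weaken (n≤1+n L) (partitions-sound L n μ μ∈below)
    ... | inj₂ μ∈top with keepIf-∈ (m ≤? n) μ∈top
    ...   | m≤n , μ∈map with ∈-map⁻ (m ∷_) μ∈map
    ...     | μ′ , μ′∈ , refl = cons-largest m n μ′ (s≤s z≤n) m≤n (withLargest-sound f (n ∸ m) μ′ μ′∈)

  partitions-complete : ∀ L n μ → PartitionBelow L n μ → μ ∈ partitions L n
  partitions-complete zero n [] (_ , _ , s , _) rewrite sym s = here refl
  partitions-complete zero n (x ∷ μ) (_ , 0<x ∷ _ , _ , x≤0 ∷ _) = ⊥-elim (<⇒≱ 0<x x≤0)
  partitions-complete (suc L) n μ pb = withLargest-complete n n μ ≤-refl pb
    where
    m = suc L
    in-below : ∀ f n μ → PartitionBelow L n μ → μ ∈ withLargest m (partitions L) n f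
    in-below zero n μ pb = partitions-complete L n μ pb
    in-below (suc f) n μ pb = ∈-++⁺ˡ (partitions-complete L n μ pb)
    withLargest-complete : ∀ f n μ → n ≤ f → PartitionBelow m n μ → μ ∈ withLargest m (partitions L) n f
    withLargest-complete f n [] _ (lk , pos , s , _) = in-below f n [] (lk , pos , s , [])
    withLargest-complete f n (x ∷ xs) n≤f pb@(lk , pos , s , x≤m ∷ _) with m≤n⇒m<n∨m≡n x≤m
    ... | inj₁ (s≤s x≤L) = in-below f n (x ∷ xs)
          (lk , pos , s , x≤L ∷ All.map (λ p → ≤-trans p x≤L) (bounded-by-head lk))
    ... | inj₂ refl = with-top f n≤f
      where
      m≤n : m ≤ n
      m≤n = subst (m ≤_) s (m≤m+n m (sum xs))
      with-top : ∀ f → n ≤ f → (m ∷ xs) ∈ withLargest m (partitions L) n f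
      with-top zero n≤0 = ⊥-elim (n≮0 (≤-trans m≤n n≤0))
      with-top (suc f) n≤f = ∈-++⁺ʳ (partitions L n) (keepIf-yes (m ≤? n) m≤n
        (∈-map⁺ (m ∷_) (withLargest-complete f (n ∸ m) xs rest≤f (drop-largest pb))))
        where
        rest≤f : n ∸ m ≤ f
        rest≤f = ≤-trans (∸-monoʳ-≤ n (s≤s z≤n)) (∸-monoˡ-≤ 1 n≤f)

  keepIf-unique : ∀ {p} {P : Set p} (d : Dec P) {xs : List (List ℕ)} → Unique xs → Unique (keepIf d xs)
  keepIf-unique (yes _) u = u
  keepIf-unique (no _) u = []

  -- the two blocks of withLargest are disjoint: only the second contains m
  partitions-unique : ∀ L n → Unique (partitions L n)
  partitions-unique zero zero = [] ∷ []
  partitions-unique zero (suc n) = []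
  partitions-unique (suc L) n = withLargest-unique n n
    where
    m = suc L
    withLargest-unique : ∀ f n → Unique (withLargest m (partitions L) n f)
    withLargest-unique zero n = partitions-unique L n
    withLargest-unique (suc f) n = Unique.++⁺ (partitions-unique L n)
      (keepIf-unique (m ≤? n) (Unique.map⁺ List.∷-injectiveʳ (withLargest-unique f (n ∸ m)))) disjoint
      where
      disjoint : Disjoint (partitions L n) (keepIf (m ≤? n) (map (m ∷_) (withLargest m (partitions L) (n ∸ m) f)))
      disjoint (μ∈below , μ∈top) with keepIf-∈ (m ≤? n) μ∈top
      ... | _ , μ∈map with ∈-map⁻ (m ∷_) μ∈map
      ...   | _ , _ , refl with partitions-sound L n _ μ∈below
      ...     | _ , _ , _ , m≤L ∷ _ = 1+n≰n m≤L

module EnumerationSums where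

  open import Data.Nat using (ℕ; zero; suc; _+_; _*_; _∸_; _≤_; z≤n; s≤s)
  open import Data.Nat.Properties
  open import Data.Nat.ListAction using (sum)
  open import Data.Nat.ListAction.Properties using (sum-++; sum-↭)
  open import Data.List using (List; []; _∷_; _++_; map; replicate)
  open import Data.List.Relation.Unary.All using (All)
  open import Data.List.Relation.Unary.Unique.Propositional using (Unique)
  open import Data.List.Membership.Propositional using (_∈_)
  open import Data.List.Membership.Propositional.Properties.WithK using (unique∧set⇒bag)
  open import Data.List.Relation.Binary.BagAndSetEquality using (∼bag⇒↭)
  import Data.List.Relation.Binary.Permutation.Propositional.Properties as Perm
  open import Data.List.Relation.Unary.Any using (here; there)
  import Data.List.Properties as List
  open import Data.Product using (proj₂)
  open import Function.Bundles using (_⇔_)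
  open import Relation.Binary.PropositionalEquality
  open import Relation.Nullary using (Dec; yes; no)
  open import Algebra.Properties.CommutativeSemigroup +-commutativeSemigroup using (interchange)
  open FormalSeries
  open Profiles
  open Enumeration

  total : (List ℕ → ℕ) → List (List ℕ) → ℕ
  total w xs = sum (map w xs)

  total-independent : ∀ (w : List ℕ → ℕ) {xs ys} → Unique xs → Unique ys →
                      (∀ {x} → (x ∈ xs) ⇔ (x ∈ ys)) → total w xs ≡ total w ys
  total-independent w ux uy same = sum-↭ (Perm.map⁺ w (∼bag⇒↭ (unique∧set⇒bag ux uy same)))

  total-cong : ∀ (f g : List ℕ → ℕ) xs → (∀ x → x ∈ xs → f x ≡ g x) → total f xs ≡ total g xs
  total-cong f g [] e = refl
  total-cong f g (x ∷ xs) e = cong₂ _+_ (e x (here refl)) (total-cong f g xs (λ y y∈ → e y (there y∈)))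

  total-+ : ∀ (f g : List ℕ → ℕ) xs → total (λ x → f x + g x) xs ≡ total f xs + total g xs
  total-+ f g [] = refl
  total-+ f g (x ∷ xs) rewrite total-+ f g xs = interchange (f x) (g x) (total f xs) (total g xs)

  total-* : ∀ c (f : List ℕ → ℕ) xs → total (λ x → c * f x) xs ≡ c * total f xs
  total-* c f [] = sym (*-zeroʳ c)
  total-* c f (x ∷ xs) rewrite total-* c f xs = sym (*-distribˡ-+ c (f x) (total f xs))

  total-++ : ∀ (f : List ℕ → ℕ) xs ys → total f (xs ++ ys) ≡ total f xs + total f ys
  total-++ f xs ys = trans (cong sum (List.map-++ f xs ys)) (sum-++ (map f xs) (map f ys))

  total-map : ∀ (f : List ℕ → ℕ) (g : List ℕ → List ℕ) xs → total f (map g xs) ≡ total (λ x → f (g x)) xs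
  total-map f g xs = cong sum (sym (List.map-∘ xs))

  total-keepIf : ∀ {p} {P : Set p} (d : Dec P) (f : List ℕ → ℕ) xs → total f (keepIf d xs) ≡ when d (total f xs)
  total-keepIf (yes _) f xs = refl
  total-keepIf (no _) f xs = refl

  total-partitions-zero : ∀ (w : List ℕ → ℕ) n → total w (partitions 0 n) ≡ w [] * 𝟙 n
  total-partitions-zero w zero = trans (+-identityʳ (w [])) (sym (*-identityʳ (w [])))
  total-partitions-zero w (suc n) = sym (*-zeroʳ (w []))

  -- Adding the part size m = L + 1.  The weight w is assumed to split along
  -- the multiplicity c of m: w (c copies of m, then μ) = a c · u μ + b c · v μ
  -- for every μ with parts ≤ L.
  module AddLargest (L : ℕ) (u v : List ℕ → ℕ) where

    m : ℕ
    m = suc L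

    Uₗ Vₗ : Series
    Uₗ n = total u (partitions L n)
    Vₗ n = total v (partitions L n)

    Splits : (List ℕ → ℕ) → (ℕ → ℕ) → (ℕ → ℕ) → Set
    Splits w a b = ∀ c μ → All (_≤ L) μ → w (replicate c m ++ μ) ≡ a c * u μ + b c * v μ

    -- the recursion computing a coefficient of profile m a ⊛ X, with fuel f
    blockSum : (ℕ → ℕ) → Series → ℕ → ℕ → ℕ
    blockSum a X n zero = a 0 * X n
    blockSum a X n (suc f) = a 0 * X n + when (m ≤? n) (blockSum (λ c → a (suc c)) X (n ∸ m) f)

    total-withLargest : ∀ f n w a b → Splits w a b →
      total w (withLargest m (partitions L) n f) ≡ blockSum a Uₗ n f + blockSum b Vₗ n f
    total-withLargest zero n w a b split = begin
      total w (partitions L n)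
        ≡⟨ total-cong w _ (partitions L n) (λ μ μ∈ → split 0 μ (proj₂ (proj₂ (proj₂ (partitions-sound L n μ μ∈))))) ⟩
      total (λ μ → a 0 * u μ + b 0 * v μ) (partitions L n)
        ≡⟨ total-+ _ _ (partitions L n) ⟩
      total (λ μ → a 0 * u μ) (partitions L n) + total (λ μ → b 0 * v μ) (partitions L n)
        ≡⟨ cong₂ _+_ (total-* (a 0) u (partitions L n)) (total-* (b 0) v (partitions L n)) ⟩
      a 0 * Uₗ n + b 0 * Vₗ n ∎
      where open ≡-Reasoning
    total-withLargest (suc f) n w a b split = begin
      total w (partitions L n ++ keepIf (m ≤? n) (map (m ∷_) rest))
        ≡⟨ total-++ w (partitions L n) _ ⟩
      total w (partitions L n) + total w (keepIf (m ≤? n) (map (m ∷_) rest))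
        ≡⟨ cong₂ _+_ (total-withLargest zero n w a b split)
                     (trans (total-keepIf (m ≤? n) w _) (cong (when (m ≤? n)) (trans (total-map w (m ∷_) rest)
                       (total-withLargest f (n ∸ m) (λ x → w (m ∷ x)) (λ c → a (suc c)) (λ c → b (suc c))
                                          (λ c → split (suc c)))))) ⟩
      (a 0 * Uₗ n + b 0 * Vₗ n) + when (m ≤? n) (blockSum (λ c → a (suc c)) Uₗ (n ∸ m) f + blockSum (λ c → b (suc c)) Vₗ (n ∸ m) f)
        ≡⟨ cong (_+_ (a 0 * Uₗ n + b 0 * Vₗ n)) (when-+ (m ≤? n) _ _) ⟩
      (a 0 * Uₗ n + b 0 * Vₗ n) + (when (m ≤? n) (blockSum (λ c → a (suc c)) Uₗ (n ∸ m) f)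
                                 + when (m ≤? n) (blockSum (λ c → b (suc c)) Vₗ (n ∸ m) f))
        ≡⟨ interchange (a 0 * Uₗ n) (b 0 * Vₗ n) _ _ ⟩
      blockSum a Uₗ n (suc f) + blockSum b Vₗ n (suc f) ∎
      where
      open ≡-Reasoning
      rest : List (List ℕ)
      rest = withLargest m (partitions L) (n ∸ m) f

    profile⊛-step : ∀ a (X : Series) n →
      (profile m a ⊛ X) n ≡ a 0 * X n + when (m ≤? n) ((profile m (λ c → a (suc c)) ⊛ X) (n ∸ m))
    profile⊛-step a X n = begin
      (profile m a ⊛ X) n
        ≡⟨ at (⊛-cong (profile-unfold m (s≤s z≤n) a) ≈-refl) n ⟩
      ((constant (a 0) ⊕ X^ m ⊛ profile m a′) ⊛ X) n
        ≡⟨ at (Laws.distribʳ X _ _) n ⟩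
      (constant (a 0) ⊛ X ⊕ (X^ m ⊛ profile m a′) ⊛ X) n
        ≡⟨ ⊕-def _ _ n ⟩
      (constant (a 0) ⊛ X) n + ((X^ m ⊛ profile m a′) ⊛ X) n
        ≡⟨ cong₂ _+_ (trans (⊛-scaleˡ (a 0) 𝟙 X n) (cong (a 0 *_) (⊛-identityˡ X n)))
                     (trans (⊛-assoc (X^ m) _ X n) (X^-⊛ m _ n)) ⟩
      a 0 * X n + when (m ≤? n) ((profile m a′ ⊛ X) (n ∸ m)) ∎
      where
      open ≡-Reasoning
      a′ : ℕ → ℕ
      a′ c = a (suc c)

    blockSum≡profile⊛ : ∀ f a (X : Series) n → n ≤ f → blockSum a X n f ≡ (profile m a ⊛ X) n
    blockSum≡profile⊛ zero a X .zero z≤n = trans (sym (+-identityʳ _)) (sym (profile⊛-step a X 0))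
    blockSum≡profile⊛ (suc f) a X n n≤f =
      trans (cong (_+_ (a 0 * X n)) (rest (m ≤? n))) (sym (profile⊛-step a X n))
      where
      rest : (d : Dec (m ≤ n)) → when d (blockSum (λ c → a (suc c)) X (n ∸ m) f)
                               ≡ when d ((profile m (λ c → a (suc c)) ⊛ X) (n ∸ m))
      rest (yes _) = blockSum≡profile⊛ f _ X (n ∸ m) (≤-trans (∸-monoʳ-≤ n (s≤s z≤n)) (∸-monoˡ-≤ 1 n≤f))
      rest (no _) = refl

    total-addLargest : ∀ w a b → Splits w a b → ∀ n →
      total w (partitions m n) ≡ (profile m a ⊛ Uₗ) n + (profile m b ⊛ Vₗ) n
    total-addLargest w a b split n = trans (total-withLargest n n w a b split)
      (cong₂ _+_ (blockSum≡profile⊛ n a Uₗ n ≤-refl) (blockSum≡profile⊛ n b Vₗ n ≤-refl))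

module Statistics (k' : ℕ) where

  open import Data.Nat using (ℕ; zero; suc; _+_; _*_; _∸_; _≤_; _<_; _%_)
  open import Data.Nat.Properties
  open import Data.Nat.Divisibility using (_∣?_)
  open import Data.Nat.Solver using (module +-*-Solver)
  open import Data.List using (List; []; _∷_; _++_; replicate; length; filter)
  open import Data.List.Relation.Unary.All using (All; []; _∷_; all?)
  import Data.List.Relation.Unary.All as All
  import Data.List.Relation.Unary.All.Properties as All
  import Data.List.Properties as List
  open import Relation.Binary.PropositionalEquality
  open import Relation.Nullary using (Dec; yes; no; does; ¬?; _×-dec_)
  open import Relation.Unary using (Pred; Decidable)
  open import Data.Product using (_×_; _,_)
  open import Data.Sum using (_⊎_; inj₁; inj₂)
  open import Data.Bool using (true; false)
  open import Defs
  open Profiles using (𝕀; 𝕀-cong; 𝕀-yes; 𝕀-no)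
  open PartSize k' using (k)
  open GeneratingSeries k' using (usesDivisible; regularMult; oneModParts)

  oneDivisibleW noDivisibleW regularW oneRepeatedW noRepeatedW restrictedW weightA weightB : List ℕ → ℕ
  oneDivisibleW μ = 𝕀 (numDistinctDivBy k μ ≟ 1)
  noDivisibleW μ = 𝕀 (numDistinctDivBy k μ ≟ 0)
  regularW μ = 𝕀 (KRegular? k μ)
  oneRepeatedW μ = 𝕀 (numDistinctRepeated k μ ≟ 1)
  noRepeatedW μ = 𝕀 (numDistinctRepeated k μ ≟ 0)
  restrictedW μ = 𝕀 (KDistinct? k μ)
  weightA μ = 𝕀 (KRegular? k μ) * numPartsOneModK k μ
  weightB μ = 𝕀 (KDistinct? k μ) * numDistinct μ

  count : ∀ {ℓ} {P : Pred ℕ ℓ} → Decidable P → List ℕ → ℕ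
  count P? xs = length (filter P? xs)

  count-∷ : ∀ {ℓ} {P : Pred ℕ ℓ} (P? : Decidable P) x xs → count P? (x ∷ xs) ≡ 𝕀 (P? x) + count P? xs
  count-∷ P? x xs with does (P? x)
  ... | true = refl
  ... | false = refl

  count-++ : ∀ {ℓ} {P : Pred ℕ ℓ} (P? : Decidable P) xs ys → count P? (xs ++ ys) ≡ count P? xs + count P? ys
  count-++ P? xs ys = trans (cong length (List.filter-++ P? xs ys)) (List.length-++ (filter P? xs))

  count-replicate : ∀ {ℓ} {P : Pred ℕ ℓ} (P? : Decidable P) c v → count P? (replicate c v) ≡ c * 𝕀 (P? v)
  count-replicate P? zero v = refl
  count-replicate P? (suc c) v = trans (count-∷ P? v (replicate c v)) (cong (_+_ (𝕀 (P? v))) (count-replicate P? c v))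

  count-cong : ∀ {ℓ ℓ'} {P : Pred ℕ ℓ} {Q : Pred ℕ ℓ'} (P? : Decidable P) (Q? : Decidable Q) xs →
               All (λ x → (P x → Q x) × (Q x → P x)) xs → count P? xs ≡ count Q? xs
  count-cong P? Q? [] [] = refl
  count-cong P? Q? (x ∷ xs) ((to , from) ∷ same) = trans (count-∷ P? x xs)
    (trans (cong₂ _+_ (𝕀-cong (P? x) (Q? x) to from) (count-cong P? Q? xs same)) (sym (count-∷ Q? x xs)))

  𝕀-bit : ∀ {a} {A : Set a} (d : Dec A) → 𝕀 d ≡ 0 ⊎ 𝕀 d ≡ 1
  𝕀-bit (yes _) = inj₂ refl
  𝕀-bit (no _) = inj₁ refl

  𝕀-× : ∀ {a b} {A : Set a} {B : Set b} (d : Dec A) (e : Dec B) → 𝕀 (d ×-dec e) ≡ 𝕀 d * 𝕀 e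
  𝕀-× (yes _) (yes _) = refl
  𝕀-× (yes _) (no _) = refl
  𝕀-× (no _) (yes _) = refl
  𝕀-× (no _) (no _) = refl

  𝕀-¬ : ∀ {a} {A : Set a} (d : Dec A) → 𝕀 (¬? d) ≡ 1 ∸ 𝕀 d
  𝕀-¬ (yes _) = refl
  𝕀-¬ (no _) = refl

  𝕀-<-complement : ∀ c → 1 ∸ 𝕀 (k ≤? c) ≡ 𝕀 (c <? k)
  𝕀-<-complement c with c <? k
  ... | yes c<k = trans (cong (1 ∸_) (𝕀-no (k ≤? c) (<⇒≱ c<k))) (sym (𝕀-yes (c <? k) c<k))
  ... | no c≮k = trans (cong (1 ∸_) (𝕀-yes (k ≤? c) (≮⇒≥ c≮k))) (sym (𝕀-no (c <? k) c≮k))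

  𝕀-all-++ : ∀ {ℓ} {P : Pred ℕ ℓ} (P? : Decidable P) xs ys → 𝕀 (all? P? (xs ++ ys)) ≡ 𝕀 (all? P? xs) * 𝕀 (all? P? ys)
  𝕀-all-++ P? xs ys = trans
    (𝕀-cong (all? P? (xs ++ ys)) (all? P? xs ×-dec all? P? ys) (All.++⁻ xs) (λ (p , q) → All.++⁺ p q))
    (𝕀-× (all? P? xs) (all? P? ys))

  𝕀-all-replicate : ∀ {ℓ} {P : Pred ℕ ℓ} (P? : Decidable P) c v → 𝕀 (all? P? (replicate (suc c) v)) ≡ 𝕀 (P? v)
  𝕀-all-replicate P? c v = 𝕀-cong (all? P? (replicate (suc c) v)) (P? v) (λ { (p ∷ _) → p }) (All.replicate⁺ (suc c))

  exactly-one-after : ∀ e d → e ≡ 0 ⊎ e ≡ 1 → 𝕀 (e + d ≟ 1) ≡ e * 𝕀 (d ≟ 0) + (1 ∸ e) * 𝕀 (d ≟ 1)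
  exactly-one-after .0 d (inj₁ refl) = sym (+-identityʳ (𝕀 (d ≟ 1)))
  exactly-one-after .1 d (inj₂ refl) = sym (trans (+-identityʳ _) (+-identityʳ _))

  none-after : ∀ e d → e ≡ 0 ⊎ e ≡ 1 → 𝕀 (e + d ≟ 0) ≡ (1 ∸ e) * 𝕀 (d ≟ 0) + 0
  none-after .0 d (inj₁ refl) = sym (trans (+-identityʳ _) (+-identityʳ _))
  none-after .1 d (inj₂ refl) = refl

  module AddSize (L : ℕ) where

    m : ℕ
    m = suc L

    m-absent : ∀ {v} → v ≤ L → m ≢ v
    m-absent v≤L m≡v = 1+n≰n (subst (_≤ L) (sym m≡v) v≤L)

    module _ (μ : List ℕ) (μ≤L : All (_≤ L) μ) where

      mult-absent : mult m μ ≡ 0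
      mult-absent = cong length (List.filter-none (m ≟_) (All.map m-absent μ≤L))

      mult-other : ∀ v c → v ≤ L → mult v (replicate c m ++ μ) ≡ mult v μ
      mult-other v c v≤L = trans (count-++ (v ≟_) (replicate c m) μ)
        (cong (_+ mult v μ) (trans (count-replicate (v ≟_) c m)
          (trans (cong (c *_) (𝕀-no (v ≟ m) (λ v≡m → m-absent v≤L (sym v≡m)))) (*-zeroʳ c))))

      mult-new : ∀ c → mult m (replicate c m ++ μ) ≡ c
      mult-new c = begin
        mult m (replicate c m ++ μ)         ≡⟨ count-++ (m ≟_) (replicate c m) μ ⟩
        count (m ≟_) (replicate c m) + mult m μ ≡⟨ cong₂ _+_ (count-replicate (m ≟_) c m) mult-absent ⟩
        c * 𝕀 (m ≟ m) + 0                   ≡⟨ cong (λ v → c * v + 0) (𝕀-yes (m ≟ m) refl) ⟩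
        c * 1 + 0                           ≡⟨ trans (+-identityʳ _) (*-identityʳ c) ⟩
        c                                   ∎
        where open ≡-Reasoning

      distinct-bounded : All (_≤ L) (distinctParts μ)
      distinct-bounded = All.deduplicate⁺ _≟_ μ≤L

      drop-m : ∀ c → filter (λ y → ¬? (m ≟ y)) (distinctParts (replicate c m ++ μ)) ≡ distinctParts μ
      drop-m zero = List.filter-all (λ y → ¬? (m ≟ y)) (All.map m-absent distinct-bounded)
      drop-m (suc c) = trans (List.filter-reject (λ y → ¬? (m ≟ y)) {x = m} (λ m≢m → m≢m refl))
                             (trans (cong (filter (λ y → ¬? (m ≟ y))) (drop-m c)) (drop-m zero))

      distinct-new : ∀ c → distinctParts (replicate (suc c) m ++ μ) ≡ m ∷ distinctParts μ
      distinct-new c = cong (m ∷_) (drop-m c)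

      numDistinctDivBy-add : ∀ c → numDistinctDivBy k (replicate c m ++ μ) ≡ usesDivisible m c + numDistinctDivBy k μ
      numDistinctDivBy-add zero = refl
      numDistinctDivBy-add (suc c) = trans (cong (count (k ∣?_)) (distinct-new c))
        (trans (count-∷ (k ∣?_) m (distinctParts μ)) (cong (_+ numDistinctDivBy k μ) (sym (*-identityˡ (𝕀 (k ∣? m))))))

      numDistinctRepeated-add : ∀ c → numDistinctRepeated k (replicate c m ++ μ) ≡ 𝕀 (k ≤? c) + numDistinctRepeated k μ
      numDistinctRepeated-add zero = refl
      numDistinctRepeated-add (suc c) = begin
        count (λ v → k ≤? mult v ν) (distinctParts ν)
          ≡⟨ cong (count (λ v → k ≤? mult v ν)) (distinct-new c) ⟩
        count (λ v → k ≤? mult v ν) (m ∷ distinctParts μ)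
          ≡⟨ count-∷ (λ v → k ≤? mult v ν) m (distinctParts μ) ⟩
        𝕀 (k ≤? mult m ν) + count (λ v → k ≤? mult v ν) (distinctParts μ)
          ≡⟨ cong₂ _+_ (cong (λ v → 𝕀 (k ≤? v)) (mult-new (suc c)))
                       (count-cong (λ v → k ≤? mult v ν) (λ v → k ≤? mult v μ) (distinctParts μ)
                         (All.map (λ v≤L → subst (k ≤_) (mult-other _ (suc c) v≤L) ,
                                            subst (k ≤_) (sym (mult-other _ (suc c) v≤L))) distinct-bounded)) ⟩
        𝕀 (k ≤? suc c) + numDistinctRepeated k μ ∎
        where
        open ≡-Reasoning
        ν : List ℕ
        ν = replicate (suc c) m ++ μ

      numDistinct-add : ∀ c → numDistinct (replicate c m ++ μ) ≡ 𝕀 (1 ≤? c) + numDistinct μ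
      numDistinct-add zero = refl
      numDistinct-add (suc c) = cong length (distinct-new c)

      numPartsOneModK-add : ∀ c → numPartsOneModK k (replicate c m ++ μ) ≡ c * 𝕀 (m % k ≟ 1 % k) + numPartsOneModK k μ
      numPartsOneModK-add c = trans (count-++ (λ p → p % k ≟ 1 % k) (replicate c m) μ)
        (cong (_+ numPartsOneModK k μ) (count-replicate (λ p → p % k ≟ 1 % k) c m))

      regular-add : ∀ c → regularW (replicate c m ++ μ) ≡ regularMult m c * regularW μ
      regular-add c = trans (𝕀-all-++ (λ p → ¬? (k ∣? p)) (replicate c m) μ) (cong (_* regularW μ) (copies c))
        where
        copies : ∀ c → 𝕀 (all? (λ p → ¬? (k ∣? p)) (replicate c m)) ≡ regularMult m c
        copies zero = refl
        copies (suc c) = trans (𝕀-all-replicate (λ p → ¬? (k ∣? p)) c m)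
          (trans (𝕀-¬ (k ∣? m)) (cong (1 ∸_) (sym (*-identityˡ (𝕀 (k ∣? m))))))

      restricted-add : ∀ c → restrictedW (replicate c m ++ μ) ≡ 𝕀 (c <? k) * restrictedW μ
      restricted-add c = trans (𝕀-all-++ (λ p → mult p ν <? k) (replicate c m) μ) (cong₂ _*_ (copies c refl) rest)
        where
        ν : List ℕ
        ν = replicate c m ++ μ
        copies : ∀ c′ → c′ ≡ c → 𝕀 (all? (λ p → mult p ν <? k) (replicate c′ m)) ≡ 𝕀 (c′ <? k)
        copies zero _ = refl
        copies (suc c′) c′+1≡c = trans (𝕀-all-replicate (λ p → mult p ν <? k) c′ m)
          (cong (λ v → 𝕀 (v <? k)) (trans (mult-new c) (sym c′+1≡c)))
        rest : 𝕀 (all? (λ p → mult p ν <? k) μ) ≡ restrictedW μ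
        rest = 𝕀-cong (all? (λ p → mult p ν <? k) μ) (KDistinct? k μ)
          (λ all< → All.zipWith (λ (v≤L , p) → subst (_< k) (mult-other _ c v≤L) p) (μ≤L , all<))
          (λ all< → All.zipWith (λ (v≤L , p) → subst (_< k) (sym (mult-other _ c v≤L)) p) (μ≤L , all<))

    usesDivisible-bit : ∀ c → usesDivisible m c ≡ 0 ⊎ usesDivisible m c ≡ 1
    usesDivisible-bit c with 𝕀-bit (1 ≤? c) | 𝕀-bit (k ∣? m)
    ... | inj₁ e | _ = inj₁ (cong (_* 𝕀 (k ∣? m)) e)
    ... | inj₂ e | inj₁ e′ = inj₁ (cong₂ _*_ e e′)
    ... | inj₂ e | inj₂ e′ = inj₂ (cong₂ _*_ e e′)

    noDivisible-splits : ∀ c μ → All (_≤ L) μ →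
      noDivisibleW (replicate c m ++ μ) ≡ regularMult m c * noDivisibleW μ + 0
    noDivisible-splits c μ μ≤L = trans (cong (λ v → 𝕀 (v ≟ 0)) (numDistinctDivBy-add μ μ≤L c))
                                       (none-after (usesDivisible m c) _ (usesDivisible-bit c))

    oneDivisible-splits : ∀ c μ → All (_≤ L) μ →
      oneDivisibleW (replicate c m ++ μ) ≡ usesDivisible m c * noDivisibleW μ + regularMult m c * oneDivisibleW μ
    oneDivisible-splits c μ μ≤L = trans (cong (λ v → 𝕀 (v ≟ 1)) (numDistinctDivBy-add μ μ≤L c))
                                        (exactly-one-after (usesDivisible m c) _ (usesDivisible-bit c))

    regular-splits : ∀ c μ → All (_≤ L) μ → regularW (replicate c m ++ μ) ≡ regularMult m c * regularW μ + 0
    regular-splits c μ μ≤L = trans (regular-add μ μ≤L c) (sym (+-identityʳ _))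

    noRepeated-splits : ∀ c μ → All (_≤ L) μ →
      noRepeatedW (replicate c m ++ μ) ≡ 𝕀 (c <? k) * noRepeatedW μ + 0
    noRepeated-splits c μ μ≤L = begin
      noRepeatedW (replicate c m ++ μ)                           ≡⟨ cong (λ v → 𝕀 (v ≟ 0)) (numDistinctRepeated-add μ μ≤L c) ⟩
      𝕀 (𝕀 (k ≤? c) + numDistinctRepeated k μ ≟ 0)               ≡⟨ none-after (𝕀 (k ≤? c)) _ (𝕀-bit (k ≤? c)) ⟩
      (1 ∸ 𝕀 (k ≤? c)) * noRepeatedW μ + 0                       ≡⟨ cong (λ v → v * noRepeatedW μ + 0) (𝕀-<-complement c) ⟩
      𝕀 (c <? k) * noRepeatedW μ + 0                             ∎
      where open ≡-Reasoning

    oneRepeated-splits : ∀ c μ → All (_≤ L) μ →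
      oneRepeatedW (replicate c m ++ μ) ≡ 𝕀 (k ≤? c) * noRepeatedW μ + 𝕀 (c <? k) * oneRepeatedW μ
    oneRepeated-splits c μ μ≤L = begin
      oneRepeatedW (replicate c m ++ μ)
        ≡⟨ cong (λ v → 𝕀 (v ≟ 1)) (numDistinctRepeated-add μ μ≤L c) ⟩
      𝕀 (𝕀 (k ≤? c) + numDistinctRepeated k μ ≟ 1)
        ≡⟨ exactly-one-after (𝕀 (k ≤? c)) _ (𝕀-bit (k ≤? c)) ⟩
      𝕀 (k ≤? c) * noRepeatedW μ + (1 ∸ 𝕀 (k ≤? c)) * oneRepeatedW μ
        ≡⟨ cong (λ v → 𝕀 (k ≤? c) * noRepeatedW μ + v * oneRepeatedW μ) (𝕀-<-complement c) ⟩
      𝕀 (k ≤? c) * noRepeatedW μ + 𝕀 (c <? k) * oneRepeatedW μ ∎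
      where open ≡-Reasoning

    restricted-splits : ∀ c μ → All (_≤ L) μ → restrictedW (replicate c m ++ μ) ≡ 𝕀 (c <? k) * restrictedW μ + 0
    restricted-splits c μ μ≤L = trans (restricted-add μ μ≤L c) (sym (+-identityʳ _))

    open +-*-Solver

    weightA-splits : ∀ c μ → All (_≤ L) μ →
      weightA (replicate c m ++ μ) ≡ oneModParts m c * regularW μ + regularMult m c * weightA μ
    weightA-splits c μ μ≤L = trans (cong₂ _*_ (regular-add μ μ≤L c) (numPartsOneModK-add μ μ≤L c))
      (solve 5 (λ r x c i n → (r :* x) :* (c :* i :+ n) := (r :* (c :* i)) :* x :+ r :* (x :* n)) refl
             (regularMult m c) (regularW μ) c (𝕀 (m % k ≟ 1 % k)) (numPartsOneModK k μ))

    weightB-splits : ∀ c μ → All (_≤ L) μ →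
      weightB (replicate c m ++ μ) ≡ (𝕀 (c <? k) * 𝕀 (1 ≤? c)) * restrictedW μ + 𝕀 (c <? k) * weightB μ
    weightB-splits c μ μ≤L = trans (cong₂ _*_ (restricted-add μ μ≤L c) (numDistinct-add μ μ≤L c))
      (solve 4 (λ t x j n → (t :* x) :* (j :+ n) := (t :* j) :* x :+ t :* (x :* n)) refl
             (𝕀 (c <? k)) (restrictedW μ) (𝕀 (1 ≤? c)) (numDistinct μ))

module Totals (k' : ℕ) where

  open import Data.Nat using (ℕ; zero; suc; _+_; _*_)
  open import Data.Nat.Properties using (+-identityʳ)
  open import Data.List using (List; [])
  open import Relation.Binary.PropositionalEquality
  open FormalSeries
  open Profiles using (profile; profile-zero)
  open Enumeration using (partitions)
  open EnumerationSums
  open GeneratingSeries k'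
  open Statistics k'

  module _ (L : ℕ) (u v w : List ℕ → ℕ) (a b : ℕ → ℕ) (split : AddLargest.Splits L u v w a b)
           {Ū V̄ : Series} (totalU : ∀ n → total u (partitions L n) ≡ Ū n)
           (totalV : ∀ n → total v (partitions L n) ≡ V̄ n) where

    total-step : ∀ n → total w (partitions (suc L) n) ≡ (profile (suc L) a ⊛ Ū ⊕ profile (suc L) b ⊛ V̄) n
    total-step n = trans (AddLargest.total-addLargest L u v w a b split n)
      (trans (cong₂ _+_ (⊛-congʳ (profile (suc L) a) totalU n) (⊛-congʳ (profile (suc L) b) totalV n))
             (sym (⊕-def _ _ n)))

  total-step₁ : ∀ L (u w : List ℕ → ℕ) (a : ℕ → ℕ) → AddLargest.Splits L u u w a (λ _ → 0) →
                {Ū : Series} → (∀ n → total u (partitions L n) ≡ Ū n) →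
                ∀ n → total w (partitions (suc L) n) ≡ (profile (suc L) a ⊛ Ū) n
  total-step₁ L u w a split {Ū} totalU n = begin
    total w (partitions (suc L) n)                                  ≡⟨ total-step L u u w a _ split totalU totalU n ⟩
    (profile (suc L) a ⊛ Ū ⊕ profile (suc L) (λ _ → 0) ⊛ Ū) n
      ≡⟨ at (⊕-cong ≈-refl (≈-trans (⊛-cong (profile-zero (suc L)) ≈-refl) (Laws.zeroˡ Ū))) n ⟩
    (profile (suc L) a ⊛ Ū ⊕ 𝟘) n                                   ≡⟨ at (Laws.+-identityʳ _) n ⟩
    (profile (suc L) a ⊛ Ū) n                                       ∎
    where open ≡-Reasoning

  total-unit : ∀ (w : List ℕ → ℕ) → w [] ≡ 1 → ∀ n → total w (partitions 0 n) ≡ 𝟙 n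
  total-unit w w[]≡1 n = trans (total-partitions-zero w n) (trans (cong (_* 𝟙 n) w[]≡1) (+-identityʳ (𝟙 n)))

  total-regular : ∀ L n → total regularW (partitions L n) ≡ Regular L n
  total-regular zero = total-unit regularW refl
  total-regular (suc L) = total-step₁ L regularW regularW _ (AddSize.regular-splits L) (total-regular L)

  total-noDivisible : ∀ L n → total noDivisibleW (partitions L n) ≡ Regular L n
  total-noDivisible zero = total-unit noDivisibleW refl
  total-noDivisible (suc L) = total-step₁ L noDivisibleW noDivisibleW _ (AddSize.noDivisible-splits L) (total-noDivisible L)

  total-oneDivisible : ∀ L n → total oneDivisibleW (partitions L n) ≡ OneDivisible L n
  total-oneDivisible zero = total-partitions-zero oneDivisibleW
  total-oneDivisible (suc L) = total-step L noDivisibleW oneDivisibleW oneDivisibleW _ _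
    (AddSize.oneDivisible-splits L) (total-noDivisible L) (total-oneDivisible L)

  total-restricted : ∀ L n → total restrictedW (partitions L n) ≡ Restricted L n
  total-restricted zero = total-unit restrictedW refl
  total-restricted (suc L) = total-step₁ L restrictedW restrictedW _ (AddSize.restricted-splits L) (total-restricted L)

  total-noRepeated : ∀ L n → total noRepeatedW (partitions L n) ≡ Restricted L n
  total-noRepeated zero = total-unit noRepeatedW refl
  total-noRepeated (suc L) = total-step₁ L noRepeatedW noRepeatedW _ (AddSize.noRepeated-splits L) (total-noRepeated L)

  total-oneRepeated : ∀ L n → total oneRepeatedW (partitions L n) ≡ OneRepeated L n
  total-oneRepeated zero = total-partitions-zero oneRepeatedW
  total-oneRepeated (suc L) = total-step L noRepeatedW oneRepeatedW oneRepeatedW _ _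
    (AddSize.oneRepeated-splits L) (total-noRepeated L) (total-oneRepeated L)

  total-weightA : ∀ L n → total weightA (partitions L n) ≡ SumA L n
  total-weightA zero = total-partitions-zero weightA
  total-weightA (suc L) = total-step L regularW weightA weightA _ _
    (AddSize.weightA-splits L) (total-regular L) (total-weightA L)

  total-weightB : ∀ L n → total weightB (partitions L n) ≡ SumB L n
  total-weightB zero = total-partitions-zero weightB
  total-weightB (suc L) = total-step L restrictedW weightB weightB _ _
    (AddSize.weightB-splits L) (total-restricted L) (total-weightB L)

module AnyEnumeration where

  open import Data.Nat using (ℕ; suc; _+_; _*_; _≤_)
  open import Data.Nat.Properties using (≤-trans; m≤m+n; m≤n+m; +-identityʳ; m+n∸m≡n)
  open import Data.Nat.ListAction using (sum)
  open import Data.List using (List; []; _∷_; filter; length)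
  open import Data.List.Relation.Unary.All using (All; []; _∷_)
  import Data.List.Relation.Unary.All as All
  open import Data.Product using (_,_)
  open import Function.Bundles using (_⇔_; mk⇔; Equivalence)
  open import Relation.Binary.PropositionalEquality
  open import Relation.Nullary using (Dec; yes; no; does)
  open import Relation.Unary using (Pred; Decidable)
  open import Data.Bool using (true; false)
  open import Data.Integer using (+_; _-_)
  open import Data.Integer.Properties using ([+m]-[+n]≡m⊖n; ⊖-≥)
  open Profiles using (𝕀)
  open Enumeration
  open EnumerationSums

  parts-bounded : ∀ xs → All (_≤ sum xs) xs
  parts-bounded [] = []
  parts-bounded (x ∷ xs) = m≤m+n x (sum xs) ∷ All.map (λ p → ≤-trans p (m≤n+m (sum xs) x)) (parts-bounded xs)

  isPartition⇔below : ∀ n μ → IsPartition n μ ⇔ PartitionBelow n n μ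
  isPartition⇔below n μ = mk⇔
    (λ ip → IsPartition.decreasing ip , IsPartition.positive ip , IsPartition.sums ip
          , subst (λ v → All (_≤ v) μ) (IsPartition.sums ip) (parts-bounded μ))
    (λ (d , p , s , _) → record { decreasing = d ; positive = p ; sums = s })

  total-elems : ∀ n (P : PartitionList n) (w : List ℕ → ℕ) → total w (elems P) ≡ total w (partitions n n)
  total-elems n P w = total-independent w (unique P) (partitions-unique n n) (λ {μ} → mk⇔
    (λ μ∈ → partitions-complete n n μ (Equivalence.to (isPartition⇔below n μ) (Equivalence.to (complete P μ) μ∈)))
    (λ μ∈ → Equivalence.from (complete P μ) (Equivalence.from (isPartition⇔below n μ) (partitions-sound n n μ μ∈))))

  length-filter≡total : ∀ {ℓ} {Q : Pred (List ℕ) ℓ} (Q? : Decidable Q) xs →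
                        length (filter Q? xs) ≡ total (λ x → 𝕀 (Q? x)) xs
  length-filter≡total Q? [] = refl
  length-filter≡total Q? (x ∷ xs) with does (Q? x)
  ... | true = cong suc (length-filter≡total Q? xs)
  ... | false = length-filter≡total Q? xs

  sumOver≡total : ∀ {Q : List ℕ → Set} (Q? : ∀ x → Dec (Q x)) (f : List ℕ → ℕ) xs →
                  sumOver Q? f xs ≡ total (λ x → 𝕀 (Q? x) * f x) xs
  sumOver≡total Q? f [] = refl
  sumOver≡total Q? f (x ∷ xs) with Q? x
  ... | yes _ = cong₂ _+_ (sym (+-identityʳ (f x))) (sumOver≡total Q? f xs)
  ... | no _ = sumOver≡total Q? f xs

  +-minus : ∀ b d → + (b + d) - + b ≡ + d
  +-minus b d = trans ([+m]-[+n]≡m⊖n (b + d) b) (trans (⊖-≥ (m≤m+n b d)) (cong +_ (m+n∸m≡n b d)))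

open import Data.Nat using (suc; s≤s; _+_)
open import Data.Product using (_,_)
open import Relation.Binary.PropositionalEquality using (trans; sym; cong; cong₂)
open import Data.Integer using (_-_)
open AnyEnumeration

theorem1p5 : (n k : ℕ) → .{{_ : NonZero k}} → 2 ≤ k → (P : PartitionList n) →
    (O1 k n P ≡ D1 k n P) × (+ D1 k n P ≡ E k n P)
theorem1p5 n (suc (suc k')) (s≤s (s≤s _)) P = O≡D , sym E≡D
  where
  open Statistics k'
  open Totals k'
  open GeneratingSeries k' using (OneDivisible; OneRepeated; SumA; SumB)
  open KeyIdentities k'
  O≡ : O1 _ n P ≡ OneDivisible n n
  O≡ = trans (length-filter≡total _ (elems P)) (trans (total-elems n P oneDivisibleW) (total-oneDivisible n n))
  D≡ : D1 _ n P ≡ OneRepeated n n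
  D≡ = trans (length-filter≡total _ (elems P)) (trans (total-elems n P oneRepeatedW) (total-oneRepeated n n))
  A≡ : A _ n P ≡ SumA n n
  A≡ = trans (sumOver≡total _ _ (elems P)) (trans (total-elems n P weightA) (total-weightA n n))
  B≡ : B _ n P ≡ SumB n n
  B≡ = trans (sumOver≡total _ _ (elems P)) (trans (total-elems n P weightB) (total-weightB n n))
  O≡D : O1 _ n P ≡ D1 _ n P
  O≡D = trans O≡ (trans (oneDivisible≡oneRepeated n) (sym D≡))
  A≡B+D : A _ n P ≡ B _ n P + D1 _ n P
  A≡B+D = trans A≡ (trans (sumA≡sumB+oneRepeated n) (sym (cong₂ _+_ B≡ D≡)))
  E≡D : E _ n P ≡ + D1 _ n P
  E≡D = trans (cong (λ a → + a - + B _ n P) A≡B+D) (+-minus (B _ n P) (D1 _ n P))
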